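{- Let $N$ be an even integer with $N \ge 6$ and let $f \ge 1$ be a real number such that $N_f := N/(2f)$ is a positive integer. Then the minimum number of links among all $N_f$-robust networks on $N$ nodes equals $\frac{N^2}{4} + \frac{N}{2} - \frac{N m}{2}$, where $m = \frac{N}{2} - N_f$.
   Context: A network is a finite simple undirected graph; links are edges. For an integer $N_f$, a network $G$ is $N_f$-robust if for every set $S$ of $N_f$ nodes of $G$, the network obtained by deleting the nodes of $S$ and their incident links is connected. -}

module Defs where

open import Data.Nat using (ℕ; _+_)
open import Data.Bool using (Bool; true; false; if_then_else_; _∧_)
open import Data.Fin using (Fin; _<?_)
open import Data.Fin.Subset using (Subset; _∈_; _∉_; ∣_∣)
open import Data.List using (List; map; allFin)
open import Data.Nat.ListAction using (sum)
open import Relation.Nullary using (does)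
open import Relation.Binary.PropositionalEquality using (_≡_)

record Graph (n : ℕ) : Set where
  field
    adj    : Fin n → Fin n → Bool
    sym    : ∀ i j → adj i j ≡ adj j i
    irrefl : ∀ i → adj i i ≡ false
open Graph public

links : ∀ {n} → Graph n → ℕ
links {n} G =
  sum (map (λ i → sum (map (λ j → if does (i <? j) ∧ adj G i j then 1 else 0)
                             (allFin n)))
           (allFin n))

data Reach {n : ℕ} (G : Graph n) (S : Subset n) : Fin n → Fin n → Set where
  here : ∀ {u} → u ∉ S → Reach G S u u
  step : ∀ {u w v} → u ∉ S → adj G u w ≡ true → Reach G S w v → Reach G S u v

ConnectedWithout : ∀ {n} → Graph n → Subset n → Set
ConnectedWithout G S = ∀ u v → u ∉ S → v ∉ S → Reach G S u v

Robust : ∀ {n} → ℕ → Graph n → Set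
Robust k G = ∀ S → ∣ S ∣ ≡ k → ConnectedWithout G S

-- With N = 2h and k = N_f the claimed minimum N²/4 + N/2 - N m/2 equals N (k + 1) / 2.
--
-- Lower bound: in a k-robust network on at least k + 2 nodes every node has degree at least k + 1,
-- for otherwise deleting its neighbours, padded up to k nodes, cuts it off from the remaining nodes.
-- The handshake lemma then gives 2 · links ≥ N (k + 1).
--
-- Upper bound: (k + 1)-regular k-robust networks. For odd k = 2r + 1 take the circulant graph on
-- ℤ/N joining nodes at circular distance at most r + 1. For even k = 2r take two copies of the
-- circulant graph on ℤ/h with distances at most r, joined by the matching x ~ h + x; if k = h add the
-- second matching x ~ h + (x + 1 mod h). A circulant graph with distances up to r stays connected
-- after deleting fewer than 2r nodes: of the two arcs between two remaining nodes one contains fewer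
-- than r deleted nodes, and it can be crossed in jumps of length at most r. In the two-layer network
-- either both layers lose fewer than 2r nodes and some matching edge survives, or one layer is intact
-- and every remaining node is joined to it.

module Submission where

open import Defs renaming (sym to adj-sym; irrefl to adj-irrefl)
open import Data.Bool using (Bool; true; false; if_then_else_; _∧_; _∨_; _xor_; not)
open import Data.Bool.Properties using (∨-comm; ∨-zeroʳ; ∧-zeroʳ; xor-comm; xor-same)
open import Data.Empty using (⊥; ⊥-elim)
open import Data.Fin as Fin using (Fin; zero; suc; toℕ; fromℕ<)
import Data.Fin.Properties as FinP
open import Data.Fin.Properties using (toℕ<n; toℕ-fromℕ<; fromℕ<-toℕ; toℕ-injective)
open import Data.Fin.Subset using (Subset; _∉_; ∣_∣)
open import Data.List using (map; allFin; tabulate)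
open import Data.List.Properties using (map-tabulate)
open import Data.Nat
open import Data.Nat.DivMod
open import Data.Nat.Divisibility using (_∣_; divides)
open import Data.Nat.Induction using (<-rec)
open import Data.Nat.ListAction using (sum)
open import Data.Nat.Properties
open import Algebra.Properties.CommutativeMonoid.Sum +-0-commutativeMonoid
  using (sum-syntax; sum-cong-≗; ∑-distrib-+; ∑-comm)
open import Data.Nat.Tactic.RingSolver using (solve-∀)
open import Data.Product using (Σ; ∃; _×_; _,_; proj₁; proj₂)
open import Data.Sum using (_⊎_; inj₁; inj₂)
open import Data.Vec using ([]; _∷_; lookup)
import Data.Vec as Vec
open import Data.Vec.Properties using (lookup∘tabulate; []=⇒lookup; lookup⇒[]=)
open import Function using (_∘_; id)
open import Relation.Binary using (tri<; tri≈; tri>)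
open import Relation.Binary.PropositionalEquality
open import Relation.Nullary
open import Relation.Nullary.Decidable using (dec-true; dec-false; _×-dec_; _⊎-dec_)

ind : Bool → ℕ
ind true  = 1
ind false = 0

ind≤1 : ∀ b → ind b ≤ 1
ind≤1 true  = ≤-refl
ind≤1 false = z≤n

ind-∨-≤ : ∀ a b → ind (a ∨ b) ≤ ind a + ind b
ind-∨-≤ true  b = s≤s z≤n
ind-∨-≤ false b = ≤-refl

ind-∨-disjoint : ∀ a b → (b ≡ true → a ≡ false) → ind (a ∨ b) ≡ ind a + ind b
ind-∨-disjoint true  true  h with () ← h refl
ind-∨-disjoint true  false h = refl
ind-∨-disjoint false b     h = refl

does-∨ : ∀ {P Q : Set} (p? : Dec P) (q? : Dec Q) → does p? ∨ does q? ≡ true → P ⊎ Q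
does-∨ (yes p) _       _ = inj₁ p
does-∨ (no _)  (yes q) _ = inj₂ q

does-∧ : ∀ {P Q : Set} (p? : Dec P) (q? : Dec Q) → does p? ∧ does q? ≡ true → P × Q
does-∧ (yes p) (yes q) _ = p , q

∑-allFin : ∀ n (f : Fin n → ℕ) → sum (map f (allFin n)) ≡ ∑[ i < n ] f i
∑-allFin n f = trans (cong sum (map-tabulate id f)) (sum-tabulate n f)
  where
  sum-tabulate : ∀ n (f : Fin n → ℕ) → sum (tabulate f) ≡ ∑[ i < n ] f i
  sum-tabulate zero    f = refl
  sum-tabulate (suc n) f = cong (f zero +_) (sum-tabulate n (f ∘ suc))

∑-mono-≤ : ∀ n {f g : Fin n → ℕ} → (∀ i → f i ≤ g i) → ∑[ i < n ] f i ≤ ∑[ i < n ] g i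
∑-mono-≤ zero    h = z≤n
∑-mono-≤ (suc n) h = +-mono-≤ (h zero) (∑-mono-≤ n (h ∘ suc))

∑-const : ∀ n c → ∑[ i < n ] c ≡ n * c
∑-const zero    c = refl
∑-const (suc n) c = cong (c +_) (∑-const n c)

sumRange : (ℕ → ℕ) → ℕ → ℕ → ℕ
sumRange f a zero    = 0
sumRange f a (suc n) = f a + sumRange f (suc a) n

Within : ℕ → ℕ → (ℕ → Set) → Set
Within a n P = ∀ i → a ≤ i → i < a + n → P i

within-head : ∀ {a n P} → Within a (suc n) P → P a
within-head {a} h = h a ≤-refl (m<m+n a (s≤s z≤n))

within-tail : ∀ {a n P} → Within a (suc n) P → Within (suc a) n P
within-tail {a} {n} h i p q = h i (≤-trans (n≤1+n a) p) (subst (i <_) (sym (+-suc a n)) q)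

sumRange-cong : ∀ {f g} a n → Within a n (λ i → f i ≡ g i) → sumRange f a n ≡ sumRange g a n
sumRange-cong a zero    h = refl
sumRange-cong a (suc n) h = cong₂ _+_ (within-head h) (sumRange-cong (suc a) n (within-tail h))

sumRange-mono-≤ : ∀ {f g} a n → Within a n (λ i → f i ≤ g i) → sumRange f a n ≤ sumRange g a n
sumRange-mono-≤ a zero    h = z≤n
sumRange-mono-≤ a (suc n) h = +-mono-≤ (within-head h) (sumRange-mono-≤ (suc a) n (within-tail h))

sumRange-++ : ∀ f a m n → sumRange f a (m + n) ≡ sumRange f a m + sumRange f (a + m) n
sumRange-++ f a zero    n = cong (λ x → sumRange f x n) (sym (+-identityʳ a))
sumRange-++ f a (suc m) n = begin
  f a + sumRange f (suc a) (m + n)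
    ≡⟨ cong (f a +_) (sumRange-++ f (suc a) m n) ⟩
  f a + (sumRange f (suc a) m + sumRange f (suc a + m) n)
    ≡⟨ cong (λ x → f a + (sumRange f (suc a) m + sumRange f x n)) (sym (+-suc a m)) ⟩
  f a + (sumRange f (suc a) m + sumRange f (a + suc m) n)
    ≡⟨ sym (+-assoc (f a) _ _) ⟩
  f a + sumRange f (suc a) m + sumRange f (a + suc m) n ∎
  where open ≡-Reasoning

sumRange-shift : ∀ f a b n → sumRange f (b + a) n ≡ sumRange (λ i → f (b + i)) a n
sumRange-shift f a b zero    = refl
sumRange-shift f a b (suc n) =
  cong (f (b + a) +_) (trans (cong (λ x → sumRange f x n) (sym (+-suc b a))) (sumRange-shift f (suc a) b n))

sumRange-from-0 : ∀ f a n → sumRange f a n ≡ sumRange (λ i → f (a + i)) 0 n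
sumRange-from-0 f a n = trans (cong (λ x → sumRange f x n) (sym (+-identityʳ a))) (sumRange-shift f 0 a n)

sumRange-distrib-+ : ∀ f g a n → sumRange (λ i → f i + g i) a n ≡ sumRange f a n + sumRange g a n
sumRange-distrib-+ f g a zero    = refl
sumRange-distrib-+ f g a (suc n) =
  trans (cong ((f a + g a) +_) (sumRange-distrib-+ f g (suc a) n)) (+-comm-middle (f a) (g a) _ _)
  where
  +-comm-middle : ∀ x y z w → (x + y) + (z + w) ≡ (x + z) + (y + w)
  +-comm-middle = solve-∀

sumRange-const : ∀ c a n → sumRange (λ _ → c) a n ≡ n * c
sumRange-const c a zero    = refl
sumRange-const c a (suc n) = cong (c +_) (sumRange-const c (suc a) n)

sumRange-zeros : ∀ f a n → Within a n (λ i → f i ≡ 0) → sumRange f a n ≡ 0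
sumRange-zeros f a n h = trans (sumRange-cong a n h) (trans (sumRange-const 0 a n) (*-zeroʳ n))

sumRange-ones : ∀ f a n → Within a n (λ i → f i ≡ 1) → sumRange f a n ≡ n
sumRange-ones f a n h = trans (sumRange-cong a n h) (trans (sumRange-const 1 a n) (*-identityʳ n))

length≤sumRange : ∀ f a n → Within a n (λ i → 1 ≤ f i) → n ≤ sumRange f a n
length≤sumRange f a n h =
  subst (_≤ sumRange f a n) (trans (sumRange-const 1 a n) (*-identityʳ n)) (sumRange-mono-≤ a n h)

sumRange<length⇒zero : ∀ f a n → sumRange f a n < n → ∃ λ i → a ≤ i × i < a + n × f i ≡ 0
sumRange<length⇒zero f a zero ()
sumRange<length⇒zero f a (suc n) lt with f a in eq
... | zero  = a , ≤-refl , m<m+n a (s≤s z≤n) , eq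
... | suc x with sumRange<length⇒zero f (suc a) n (≤-trans (s≤s (m≤n+m _ x)) (s≤s⁻¹ lt))
...   | i , p , q , e = i , ≤-trans (n≤1+n a) p , subst (i <_) (sym (+-suc a n)) q , e

sumRange≡0⇒zero : ∀ f a n → sumRange f a n ≡ 0 → Within a n (λ i → f i ≡ 0)
sumRange≡0⇒zero f a zero    e i p q = ⊥-elim (<⇒≱ q (subst (_≤ i) (sym (+-identityʳ a)) p))
sumRange≡0⇒zero f a (suc n) e i p q with m≤n⇒m<n∨m≡n p
... | inj₂ refl = m+n≡0⇒m≡0 (f a) e
... | inj₁ lt   = sumRange≡0⇒zero f (suc a) n (m+n≡0⇒n≡0 (f a) e) i lt (subst (i <_) (+-suc a n) q)

sumRange-subrange : ∀ f a n b k → a ≤ b → b + k ≤ a + n → sumRange f b k ≤ sumRange f a n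
sumRange-subrange f a n b k ab le = begin
  sumRange f b k                               ≡⟨ cong (λ z → sumRange f z k) (sym (m+[n∸m]≡n ab)) ⟩
  sumRange f (a + (b ∸ a)) k                   ≤⟨ m≤n+m _ _ ⟩
  sumRange f a (b ∸ a) + sumRange f (a + (b ∸ a)) k ≡⟨ sym (sumRange-++ f a (b ∸ a) k) ⟩
  sumRange f a (b ∸ a + k)                     ≤⟨ m≤m+n _ _ ⟩
  sumRange f a (b ∸ a + k) + sumRange f (a + (b ∸ a + k)) (n ∸ (b ∸ a + k)) ≡⟨ sym (sumRange-++ f a (b ∸ a + k) _) ⟩
  sumRange f a (b ∸ a + k + (n ∸ (b ∸ a + k))) ≡⟨ cong (sumRange f a) (m+[n∸m]≡n inner≤n) ⟩
  sumRange f a n ∎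
  where
  open ≤-Reasoning
  inner≤n : b ∸ a + k ≤ n
  inner≤n = +-cancelˡ-≤ a _ _
    (subst (_≤ a + n) (trans (cong (_+ k) (sym (m+[n∸m]≡n ab))) (+-assoc a (b ∸ a) k)) le)

sumRange-ind-unique : ∀ (P : ℕ → Bool) a n →
  Within a n (λ i → Within a n (λ j → P i ≡ true → P j ≡ true → i ≡ j)) → sumRange (ind ∘ P) a n ≤ 1
sumRange-ind-unique P a zero    h = z≤n
sumRange-ind-unique P a (suc n) h with P a in pa
... | true  = ≤-reflexive (cong suc (sumRange-zeros (ind ∘ P) (suc a) n others-false))
  where
  others-false : Within (suc a) n (λ i → ind (P i) ≡ 0)
  others-false i p q with P i in pi
  ... | false = refl
  ... | true with () ← <-irrefl (within-head h i (≤-trans (n≤1+n a) p) (subst (i <_) (sym (+-suc a n)) q) pa pi) p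
... | false = sumRange-ind-unique P (suc a) n (λ i p q j p′ q′ → within-tail (within-tail h i p q) j p′ q′)

∑-toℕ : ∀ n (g : ℕ → ℕ) → ∑[ i < n ] g (toℕ i) ≡ sumRange g 0 n
∑-toℕ zero    g = refl
∑-toℕ (suc n) g = cong (g 0 +_) (trans (∑-toℕ n (g ∘ suc)) (sym (sumRange-shift g 0 1 n)))

sumRange≤length : ∀ f a n → Within a n (λ i → f i ≤ 1) → sumRange f a n ≤ n
sumRange≤length f a n bits =
  subst (sumRange f a n ≤_) (trans (sumRange-const 1 a n) (*-identityʳ n)) (sumRange-mono-≤ a n bits)

sumRange≤pred-length : ∀ f a n x → Within a n (λ i → f i ≤ 1) → a ≤ x → x < a + n → f x ≡ 0 →
                       sumRange f a n ≤ n ∸ 1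
sumRange≤pred-length f a zero    x bits a≤x x< _ = z≤n
sumRange≤pred-length f a (suc n) x bits a≤x x< fx≡0 with m≤n⇒m<n∨m≡n a≤x
... | inj₂ refl = subst (λ z → z + sumRange f (suc a) n ≤ n) (sym fx≡0) (sumRange≤length f (suc a) n (within-tail bits))
... | inj₁ a<x with n
...   | zero  = ⊥-elim (<⇒≱ x< (subst (_≤ x) (+-comm 1 a) a<x))
...   | suc m = +-mono-≤ (within-head bits)
                  (sumRange≤pred-length f (suc a) (suc m) x (within-tail bits) a<x (subst (x <_) (+-suc a (suc m)) x<) fx≡0)

sumRange-tight : ∀ f a n → Within a n (λ i → 1 ≤ f i) → sumRange f a n ≤ n → Within a n (λ i → f i ≡ 1)
sumRange-tight f a zero    _  _   i a≤i i< = ⊥-elim (<⇒≱ i< (subst (_≤ i) (sym (+-identityʳ a)) a≤i))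
sumRange-tight f a (suc n) ≥1 sum≤ i a≤i i< with m≤n⇒m<n∨m≡n a≤i
... | inj₂ refl = ≤-antisym (+-cancelʳ-≤ n (f a) 1 (≤-trans (+-monoʳ-≤ (f a) (length≤sumRange f (suc a) n (within-tail ≥1))) sum≤))
                    (within-head ≥1)
... | inj₁ a<i  = sumRange-tight f (suc a) n (within-tail ≥1)
                    (+-cancelˡ-≤ 1 _ _ (≤-trans (+-monoˡ-≤ _ (within-head ≥1)) sum≤)) i a<i (subst (i <_) (+-suc a n) i<)

lookup≡false⇒∉ : ∀ {n} (S : Subset n) i → lookup S i ≡ false → i ∉ S
lookup≡false⇒∉ S i e i∈S with () ← trans (sym ([]=⇒lookup i∈S)) e

∉⇒lookup≡false : ∀ {n} (S : Subset n) i → i ∉ S → lookup S i ≡ false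
∉⇒lookup≡false S i i∉S with lookup S i in eq
... | true  = ⊥-elim (i∉S (lookup⇒[]= i S eq))
... | false = refl

∣S∣≡∑lookup : ∀ {n} (S : Subset n) → ∣ S ∣ ≡ ∑[ i < n ] ind (lookup S i)
∣S∣≡∑lookup []          = refl
∣S∣≡∑lookup (true ∷ S)  = cong suc (∣S∣≡∑lookup S)
∣S∣≡∑lookup (false ∷ S) = ∣S∣≡∑lookup S

module _ {n} (G : Graph n) (S : Subset n) where

  reach-start : ∀ {u v} → Reach G S u v → u ∉ S
  reach-start (here u∉S)     = u∉S
  reach-start (step u∉S _ _) = u∉S

  reach-trans : ∀ {u v w} → Reach G S u v → Reach G S v w → Reach G S u w
  reach-trans (here _)       r′ = r′
  reach-trans (step u∉S e r) r′ = step u∉S e (reach-trans r r′)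

  reach-edge : ∀ {u v} → u ∉ S → v ∉ S → adj G u v ≡ true → Reach G S u v
  reach-edge u∉S v∉S e = step u∉S e (here v∉S)

  reach-sym : ∀ {u v} → Reach G S u v → Reach G S v u
  reach-sym (here u∉S) = here u∉S
  reach-sym (step {u} {w} u∉S e r) =
    reach-trans (reach-sym r) (reach-edge (reach-start r) u∉S (trans (adj-sym G w u) e))

  hub⇒connected : ∀ hub → (∀ w → w ∉ S → Reach G S w hub) → ConnectedWithout G S
  hub⇒connected hub to-hub u v u∉S v∉S = reach-trans (to-hub u u∉S) (reach-sym (to-hub v v∉S))

count : ∀ {n} → (Fin n → Bool) → ℕ
count {n} P = ∑[ i < n ] ind (P i)

∣tabulate∣ : ∀ {n} (P : Fin n → Bool) → ∣ Vec.tabulate P ∣ ≡ count P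
∣tabulate∣ {n} P =
  trans (∣S∣≡∑lookup (Vec.tabulate P)) (sum-cong-≗ {n} (λ i → cong ind (lookup∘tabulate P i)))

count-≟ : ∀ {n} (v : Fin n) → count (λ j → does (j Fin.≟ v)) ≡ 1
count-≟ {suc n} zero    = cong suc (trans (∑-const n 0) (*-zeroʳ n))
count-≟ {suc n} (suc v) = trans (sum-cong-≗ {n} suc≟suc) (count-≟ v)
  where
  suc≟suc : ∀ j → ind (does (suc j Fin.≟ suc v)) ≡ ind (does (j Fin.≟ v))
  suc≟suc j with j Fin.≟ v
  ... | yes _ = refl
  ... | no _  = refl

count-pos : ∀ {n} (P : Fin n → Bool) → 1 ≤ count P → ∃ λ u → P u ≡ true
count-pos {suc n} P pos with P zero in eq
... | true  = zero , eq
... | false with count-pos (P ∘ suc) pos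
...   | u , e = suc u , e

count-choose : ∀ {n} (P : Fin n → Bool) m → m ≤ count P →
               Σ (Fin n → Bool) λ Q → (∀ i → Q i ≡ true → P i ≡ true) × count Q ≡ m
count-choose {zero}  P zero    _ = (λ ()) , (λ ()) , refl
count-choose {suc n} P zero    _ =
  (λ _ → false) , (λ _ ()) , trans (∑-const (suc n) 0) (*-zeroʳ n)
count-choose {suc n} P (suc m) le with P zero in eq
... | true with count-choose (P ∘ suc) m (s≤s⁻¹ le)
...   | Q , Q⊆P , ∣Q∣ = Q₀ , Q₀⊆P , cong suc ∣Q∣
  where
  Q₀ : Fin (suc n) → Bool
  Q₀ zero    = true
  Q₀ (suc i) = Q i
  Q₀⊆P : ∀ i → Q₀ i ≡ true → P i ≡ true
  Q₀⊆P zero    _ = eq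
  Q₀⊆P (suc i) e = Q⊆P i e
count-choose {suc n} P (suc m) le | false with count-choose (P ∘ suc) (suc m) le
...   | Q , Q⊆P , ∣Q∣ = Q₀ , Q₀⊆P , ∣Q∣
  where
  Q₀ : Fin (suc n) → Bool
  Q₀ zero    = false
  Q₀ (suc i) = Q i
  Q₀⊆P : ∀ i → Q₀ i ≡ true → P i ≡ true
  Q₀⊆P (suc i) e = Q⊆P i e

degree : ∀ {n} → Graph n → Fin n → ℕ
degree G v = count (adj G v)

module _ {n} (G : Graph n) where

  private
    forward : Fin n → Fin n → ℕ
    forward i j = ind (does (i Fin.<? j) ∧ adj G i j)

    links≡∑forward : links G ≡ ∑[ i < n ] ∑[ j < n ] forward i j
    links≡∑forward = trans (∑-allFin n _)
      (sum-cong-≗ {n} λ i → trans (∑-allFin n _) (sum-cong-≗ {n} λ j → if-ind (does (i Fin.<? j) ∧ adj G i j)))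
      where
      if-ind : ∀ b → (if b then 1 else 0) ≡ ind b
      if-ind true  = refl
      if-ind false = refl

    forward+backward : ∀ i j → forward i j + forward j i ≡ ind (adj G i j)
    forward+backward i j with FinP.<-cmp i j
    ... | tri< i<j _ j≮i rewrite dec-true (i Fin.<? j) i<j | dec-false (j Fin.<? i) j≮i = +-identityʳ _
    ... | tri> i≮j _ j<i rewrite dec-false (i Fin.<? j) i≮j | dec-true (j Fin.<? i) j<i = cong ind (adj-sym G j i)
    ... | tri≈ i≮i refl _ rewrite dec-false (i Fin.<? i) i≮i | adj-irrefl G i = refl

  handshake : links G * 2 ≡ ∑[ v < n ] degree G v
  handshake = begin
    links G * 2                                        ≡⟨ *-comm (links G) 2 ⟩
    links G + (links G + 0)                            ≡⟨ cong (links G +_) (+-identityʳ _) ⟩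
    links G + links G                                  ≡⟨ cong₂ _+_ links≡∑forward (trans links≡∑forward (∑-comm forward)) ⟩
    ∑[ i < n ] ∑[ j < n ] forward i j + ∑[ i < n ] ∑[ j < n ] forward j i
      ≡⟨ sym (∑-distrib-+ (λ i → ∑[ j < n ] forward i j) (λ i → ∑[ j < n ] forward j i)) ⟩
    ∑[ i < n ] (∑[ j < n ] forward i j + ∑[ j < n ] forward j i)
      ≡⟨ sum-cong-≗ {n} (λ i → sym (∑-distrib-+ (forward i) (λ j → forward j i))) ⟩
    ∑[ i < n ] ∑[ j < n ] (forward i j + forward j i)  ≡⟨ sum-cong-≗ {n} (λ i → sum-cong-≗ {n} (forward+backward i)) ⟩
    ∑[ v < n ] degree G v ∎
    where open ≡-Reasoning

module DegreeLowerBound {n} (G : Graph n) (k : ℕ) (robust : Robust k G) (k+2≤n : k + 2 ≤ n)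
                        (v : Fin n) (small : degree G v ≤ k) where

  neighbour : Fin n → Bool
  neighbour = adj G v

  stranger : Fin n → Bool
  stranger j = not (neighbour j) ∧ not (does (j Fin.≟ v))

  private
    d : ℕ
    d = degree G v
    c : ℕ
    c = count stranger

  n≤strangers+d+1 : n ≤ c + d + 1
  n≤strangers+d+1 = begin
    n                                    ≡⟨ sym (trans (∑-const n 1) (*-identityʳ n)) ⟩
    ∑[ j < n ] 1                         ≤⟨ ∑-mono-≤ n (λ j → covered (neighbour j) (does (j Fin.≟ v))) ⟩
    ∑[ j < n ] (ind (stranger j) + ind (neighbour j) + ind (does (j Fin.≟ v)))
      ≡⟨ ∑-distrib-+ (λ j → ind (stranger j) + ind (neighbour j)) (λ j → ind (does (j Fin.≟ v))) ⟩
    ∑[ j < n ] (ind (stranger j) + ind (neighbour j)) + count (λ j → does (j Fin.≟ v))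
      ≡⟨ cong₂ _+_ (∑-distrib-+ (λ j → ind (stranger j)) (λ j → ind (neighbour j))) (count-≟ v) ⟩
    c + d + 1 ∎
    where
    open ≤-Reasoning
    covered : ∀ a b → 1 ≤ ind (not a ∧ not b) + ind a + ind b
    covered true  _     = s≤s z≤n
    covered false true  = s≤s z≤n
    covered false false = s≤s z≤n

  private
    chosen : Σ (Fin n → Bool) λ Q → (∀ i → Q i ≡ true → stranger i ≡ true) × count Q ≡ k ∸ d
    chosen = count-choose stranger (k ∸ d)
      (m≤n+o⇒m∸n≤o k d (+-cancelʳ-≤ 1 k (d + c) (begin
        k + 1     ≤⟨ ≤-trans (+-monoʳ-≤ k (n≤1+n 1)) k+2≤n ⟩
        n         ≤⟨ n≤strangers+d+1 ⟩
        c + d + 1 ≡⟨ cong (_+ 1) (+-comm c d) ⟩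
        d + c + 1 ∎)))
      where open ≤-Reasoning

  padding : Fin n → Bool
  padding = proj₁ chosen

  padding⊆stranger : ∀ j → padding j ≡ true → stranger j ≡ true
  padding⊆stranger = proj₁ (proj₂ chosen)

  separator : Subset n
  separator = Vec.tabulate (λ j → neighbour j ∨ padding j)

  ∣separator∣ : ∣ separator ∣ ≡ k
  ∣separator∣ = begin
    ∣ separator ∣                                 ≡⟨ ∣tabulate∣ (λ j → neighbour j ∨ padding j) ⟩
    ∑[ j < n ] ind (neighbour j ∨ padding j)
      ≡⟨ sum-cong-≗ {n} (λ j → ind-∨-disjoint (neighbour j) (padding j) (padding⇒¬neighbour j)) ⟩
    ∑[ j < n ] (ind (neighbour j) + ind (padding j)) ≡⟨ ∑-distrib-+ (λ j → ind (neighbour j)) (λ j → ind (padding j)) ⟩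
    d + count padding                             ≡⟨ cong (d +_) (proj₂ (proj₂ chosen)) ⟩
    d + (k ∸ d)                                   ≡⟨ m+[n∸m]≡n small ⟩
    k ∎
    where
    open ≡-Reasoning
    padding⇒¬neighbour : ∀ j → padding j ≡ true → neighbour j ≡ false
    padding⇒¬neighbour j e with neighbour j | padding⊆stranger j e
    ... | false | _ = refl

  isolated : ∀ {w} → Reach G separator v w → w ≡ v
  isolated (here _)                 = refl
  isolated (step {w = w} _ vw r) with () ← reach-start G separator r
    (lookup⇒[]= w separator (trans (lookup∘tabulate _ w) (cong (_∨ padding w) vw)))

  unpadded : Fin n → Bool
  unpadded j = stranger j ∧ not (padding j)

  outsider : ∃ λ u → unpadded u ≡ true
  outsider = count-pos _ (+-cancelʳ-≤ (k + 1) 1 _ (begin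
    1 + (k + 1)                                  ≡⟨ +-comm 1 (k + 1) ⟩
    k + 1 + 1                                    ≡⟨ +-assoc k 1 1 ⟩
    k + 2                                        ≤⟨ k+2≤n ⟩
    n                                            ≤⟨ n≤strangers+d+1 ⟩
    c + d + 1                                    ≤⟨ +-monoˡ-≤ 1 (+-monoˡ-≤ d (∑-mono-≤ n (λ j → split (stranger j) (padding j)))) ⟩
    ∑[ j < n ] (ind (unpadded j) + ind (padding j)) + d + 1
      ≡⟨ cong (λ x → x + d + 1) (∑-distrib-+ (λ j → ind (unpadded j)) (λ j → ind (padding j))) ⟩
    count unpadded + count padding + d + 1
      ≡⟨ cong (λ x → count unpadded + x + d + 1) (proj₂ (proj₂ chosen)) ⟩
    count unpadded + (k ∸ d) + d + 1
      ≡⟨ cong (_+ 1) (trans (+-assoc _ (k ∸ d) d) (cong (count unpadded +_) (m∸n+n≡m small))) ⟩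
    count unpadded + k + 1
      ≡⟨ +-assoc _ k 1 ⟩
    count unpadded + (k + 1) ∎))
    where
    open ≤-Reasoning
    split : ∀ a b → ind a ≤ ind (a ∧ not b) + ind b
    split true  true  = s≤s z≤n
    split true  false = s≤s z≤n
    split false _     = z≤n

  separated : ⊥
  separated with outsider
  ... | u , outside with stranger u in su | padding u in pu
  -- the omitted cases are refuted by outside and su
  ... | true | false with neighbour u in nu | u Fin.≟ v
  ...   | false | no u≢v = u≢v (isolated (robust separator ∣separator∣ v u v∉ u∉))
    where
    v∉ : v ∉ separator
    v∉ = lookup≡false⇒∉ separator v (trans (lookup∘tabulate _ v) (cong₂ _∨_ (adj-irrefl G v) padding-v))
      where
      padding-v : padding v ≡ false
      padding-v with padding v in pv
      ... | false = refl
      ... | true with () ← trans (sym (padding⊆stranger v pv)) (trans (cong (λ b → not (neighbour v) ∧ not b) (dec-true (v Fin.≟ v) refl)) (∧-zeroʳ _))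
    u∉ : u ∉ separator
    u∉ = lookup≡false⇒∉ separator u (trans (lookup∘tabulate _ u) (cong₂ _∨_ nu pu))

robust⇒degree≥ : ∀ {n} (G : Graph n) k → Robust k G → k + 2 ≤ n → ∀ v → suc k ≤ degree G v
robust⇒degree≥ G k robust k+2≤n v with suc k ≤? degree G v
... | yes k<d = k<d
... | no  k≮d = ⊥-elim (DegreeLowerBound.separated G k robust k+2≤n v (≤-pred (≰⇒> k≮d)))

robust⇒links≥ : ∀ {n} (G : Graph n) k → Robust k G → k + 2 ≤ n → n * suc k ≤ links G * 2
robust⇒links≥ {n} G k robust k+2≤n =
  subst₂ _≤_ (∑-const n (suc k)) (sym (handshake G)) (∑-mono-≤ n (robust⇒degree≥ G k robust k+2≤n))

[m+n]%o≡[m%o+n]%o : ∀ m n o .{{_ : NonZero o}} → (m + n) % o ≡ (m % o + n) % o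
[m+n]%o≡[m%o+n]%o m n o = trans (%-distribˡ-+ m n o)
  (sym (trans (%-distribˡ-+ (m % o) n o) (cong (λ z → (z + n % o) % o) (m%n%n≡m%n m o))))

m%n≡m∸n : ∀ m n .{{_ : NonZero n}} → n ≤ m → m < n + n → m % n ≡ m ∸ n
m%n≡m∸n m n n≤m m<2n = trans (sym (m≤n⇒[n∸m]%m≡n%m n≤m))
  (m<n⇒m%n≡m (+-cancelʳ-< n (m ∸ n) n (subst (_< n + n) (sym (m∸n+n≡m n≤m)) m<2n)))

sumRange-rotate : ∀ M .{{_ : NonZero M}} (f : ℕ → ℕ) c → c ≤ M →
                  sumRange (λ s → f ((c + s) % M)) 0 M ≡ sumRange f 0 M
sumRange-rotate M f c c≤M = begin
  sumRange g 0 M                                  ≡⟨ cong (sumRange g 0) (sym (m∸n+n≡m c≤M)) ⟩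
  sumRange g 0 ((M ∸ c) + c)                      ≡⟨ sumRange-++ g 0 (M ∸ c) c ⟩
  sumRange g 0 (M ∸ c) + sumRange g (M ∸ c) c     ≡⟨ cong₂ _+_ before-wrap after-wrap ⟩
  sumRange f c (M ∸ c) + sumRange f 0 c           ≡⟨ +-comm _ (sumRange f 0 c) ⟩
  sumRange f 0 c + sumRange f (0 + c) (M ∸ c)     ≡⟨ sym (sumRange-++ f 0 c (M ∸ c)) ⟩
  sumRange f 0 (c + (M ∸ c))                      ≡⟨ cong (sumRange f 0) (m+[n∸m]≡n c≤M) ⟩
  sumRange f 0 M ∎
  where
  open ≡-Reasoning
  g : ℕ → ℕ
  g s = f ((c + s) % M)
  before-wrap : sumRange g 0 (M ∸ c) ≡ sumRange f c (M ∸ c)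
  before-wrap = trans
    (sumRange-cong 0 (M ∸ c) (λ i _ i< → cong f (m<n⇒m%n≡m (subst (c + i <_) (m+[n∸m]≡n c≤M) (+-monoʳ-< c i<)))))
    (sym (sumRange-from-0 f c (M ∸ c)))
  after-wrap : sumRange g (M ∸ c) c ≡ sumRange f 0 c
  after-wrap = trans (sumRange-from-0 g (M ∸ c) c) (sumRange-cong 0 c λ i _ i<c → cong f (begin
    (c + (M ∸ c + i)) % M ≡⟨ cong (_% M) (trans (sym (+-assoc c (M ∸ c) i)) (cong (_+ i) (m+[n∸m]≡n c≤M))) ⟩
    (M + i) % M           ≡⟨ cong (_% M) (+-comm M i) ⟩
    (i + M) % M           ≡⟨ [m+n]%n≡m%n i M ⟩
    i % M                 ≡⟨ m<n⇒m%n≡m (≤-trans i<c c≤M) ⟩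
    i ∎))

wrap+gap : ∀ {x y} M → x ≤ y → y ≤ x + M → (x + M ∸ y) + (y ∸ x) ≡ M
wrap+gap {x} {y} M x≤y y≤x+M = begin
  (x + M ∸ y) + (y ∸ x)           ≡⟨ cong (λ z → (x + M ∸ z) + (y ∸ x)) (sym (m+[n∸m]≡n x≤y)) ⟩
  (x + M ∸ (x + (y ∸ x))) + (y ∸ x) ≡⟨ cong (_+ (y ∸ x)) ([m+n]∸[m+o]≡n∸o x M (y ∸ x)) ⟩
  (M ∸ (y ∸ x)) + (y ∸ x)         ≡⟨ m∸n+n≡m (m≤n+o⇒m∸n≤o y x y≤x+M) ⟩
  M ∎
  where open ≡-Reasoning

clockwise : ℕ → ℕ → ℕ → ℕ
clockwise M a b = if does (a ≤? b) then b ∸ a else (b + M) ∸ a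

module _ (M : ℕ) where

  clockwise-≤ : ∀ {a b} → a ≤ b → clockwise M a b ≡ b ∸ a
  clockwise-≤ {a} {b} a≤b rewrite dec-true (a ≤? b) a≤b = refl

  clockwise-> : ∀ {a b} → b < a → clockwise M a b ≡ (b + M) ∸ a
  clockwise-> {a} {b} b<a rewrite dec-false (a ≤? b) (<⇒≱ b<a) = refl

  clockwise-self : ∀ a → clockwise M a a ≡ 0
  clockwise-self a = trans (clockwise-≤ {a} ≤-refl) (n∸n≡0 a)

  clockwise-pos : ∀ {a b} → a < M → a ≢ b → 1 ≤ clockwise M a b
  clockwise-pos {a} {b} a<M a≢b with a ≤? b
  ... | yes a≤b = subst (1 ≤_) (sym (clockwise-≤ a≤b)) (m<n⇒0<n∸m (≤∧≢⇒< a≤b a≢b))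
  ... | no  a≰b = subst (1 ≤_) (sym (clockwise-> (≰⇒> a≰b))) (m<n⇒0<n∸m (≤-trans a<M (m≤n+m M b)))

  clockwise<M : ∀ {a b} → a < M → b < M → clockwise M a b < M
  clockwise<M {a} {b} a<M b<M with a ≤? b
  ... | yes a≤b = subst (_< M) (sym (clockwise-≤ a≤b)) (≤-<-trans (m∸n≤m b a) b<M)
  ... | no  a≰b = subst (_< M) (sym (clockwise-> (≰⇒> a≰b)))
    (+-cancelʳ-< a _ M (subst (_< M + a) (sym (m∸n+n≡m (≤-trans (<⇒≤ a<M) (m≤n+m M b))))
      (subst (_< M + a) (+-comm M b) (+-monoʳ-< M (≰⇒> a≰b)))))

  clockwise-anti : ∀ {a b} → a < M → b < M → a ≢ b → clockwise M b a + clockwise M a b ≡ M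
  clockwise-anti {a} {b} a<M b<M a≢b with <-cmp a b
  ... | tri≈ _ a≡b _ = ⊥-elim (a≢b a≡b)
  ... | tri< a<b _ _ rewrite clockwise-> a<b | clockwise-≤ (<⇒≤ a<b) =
    wrap+gap M (<⇒≤ a<b) (≤-trans (<⇒≤ b<M) (m≤n+m M a))
  ... | tri> _ _ b<a rewrite clockwise-≤ (<⇒≤ b<a) | clockwise-> b<a =
    trans (+-comm (a ∸ b) _) (wrap+gap M (<⇒≤ b<a) (≤-trans (<⇒≤ a<M) (m≤n+m M b)))

module _ (M : ℕ) .{{_ : NonZero M}} where

  clockwise-step : ∀ a d → a < M → d < M → clockwise M a ((a + d) % M) ≡ d
  clockwise-step a d a<M d<M with a + d <? M
  ... | yes a+d<M = trans (cong (clockwise M a) (m<n⇒m%n≡m a+d<M)) (trans (clockwise-≤ M (m≤m+n a d)) (m+n∸m≡n a d))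
  ... | no  a+d≮M = begin
    clockwise M a ((a + d) % M) ≡⟨ cong (clockwise M a) (m%n≡m∸n (a + d) M M≤a+d (+-mono-< a<M d<M)) ⟩
    clockwise M a (a + d ∸ M)   ≡⟨ clockwise-> M wrapped<a ⟩
    a + d ∸ M + M ∸ a           ≡⟨ cong (_∸ a) (m∸n+n≡m M≤a+d) ⟩
    a + d ∸ a                   ≡⟨ m+n∸m≡n a d ⟩
    d ∎
    where
    open ≡-Reasoning
    M≤a+d : M ≤ a + d
    M≤a+d = ≮⇒≥ a+d≮M
    wrapped<a : a + d ∸ M < a
    wrapped<a = +-cancelʳ-< M _ a (subst (_< a + M) (sym (m∸n+n≡m M≤a+d)) (+-monoʳ-< a d<M))

  clockwise-target : ∀ a b → a < M → b < M → (a + clockwise M a b) % M ≡ b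
  clockwise-target a b a<M b<M with a ≤? b
  ... | yes a≤b = begin
    (a + clockwise M a b) % M ≡⟨ cong (λ z → (a + z) % M) (clockwise-≤ M a≤b) ⟩
    (a + (b ∸ a)) % M         ≡⟨ cong (_% M) (m+[n∸m]≡n a≤b) ⟩
    b % M                     ≡⟨ m<n⇒m%n≡m b<M ⟩
    b ∎
    where open ≡-Reasoning
  ... | no a≰b = begin
    (a + clockwise M a b) % M ≡⟨ cong (λ z → (a + z) % M) (clockwise-> M (≰⇒> a≰b)) ⟩
    (a + (b + M ∸ a)) % M     ≡⟨ cong (_% M) (m+[n∸m]≡n (≤-trans (<⇒≤ a<M) (m≤n+m M b))) ⟩
    (b + M) % M               ≡⟨ [m+n]%n≡m%n b M ⟩
    b % M                     ≡⟨ m<n⇒m%n≡m b<M ⟩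
    b ∎
    where open ≡-Reasoning

  clockwise≡rotated : ∀ a b → a < M → b < M → clockwise M a b ≡ (M ∸ a + b) % M
  clockwise≡rotated a b a<M b<M with a ≤? b
  ... | yes a≤b = begin
    clockwise M a b         ≡⟨ clockwise-≤ M a≤b ⟩
    b ∸ a                   ≡⟨ sym (m<n⇒m%n≡m (≤-<-trans (m∸n≤m b a) b<M)) ⟩
    (b ∸ a) % M             ≡⟨ sym ([m+n]%n≡m%n (b ∸ a) M) ⟩
    (b ∸ a + M) % M         ≡⟨ cong (_% M) (sym (+-∸-comm M a≤b)) ⟩
    (b + M ∸ a) % M         ≡⟨ cong (_% M) (+-∸-assoc b (<⇒≤ a<M)) ⟩
    (b + (M ∸ a)) % M       ≡⟨ cong (_% M) (+-comm b (M ∸ a)) ⟩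
    (M ∸ a + b) % M ∎
    where open ≡-Reasoning
  ... | no a≰b = begin
    clockwise M a b         ≡⟨ clockwise-> M (≰⇒> a≰b) ⟩
    b + M ∸ a               ≡⟨ sym (m<n⇒m%n≡m (clockwise-step-bound)) ⟩
    (b + M ∸ a) % M         ≡⟨ cong (_% M) (+-∸-assoc b (<⇒≤ a<M)) ⟩
    (b + (M ∸ a)) % M       ≡⟨ cong (_% M) (+-comm b (M ∸ a)) ⟩
    (M ∸ a + b) % M ∎
    where
    open ≡-Reasoning
    clockwise-step-bound : b + M ∸ a < M
    clockwise-step-bound = subst (_< M) (clockwise-> M (≰⇒> a≰b)) (clockwise<M M a<M b<M)

inBand : ℕ → ℕ → Bool
inBand r t = does (1 ≤? t) ∧ does (t ≤? r)

inBand-intro : ∀ {r t} → 1 ≤ t → t ≤ r → inBand r t ≡ true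
inBand-intro {r} {t} 1≤t t≤r rewrite dec-true (1 ≤? t) 1≤t | dec-true (t ≤? r) t≤r = refl

inBand⇒≤ : ∀ r t → inBand r t ≡ true → t ≤ r
inBand⇒≤ r t = from (1 ≤? t) (t ≤? r)
  where
  from : (a : Dec (1 ≤ t)) (b : Dec (t ≤ r)) → does a ∧ does b ≡ true → t ≤ r
  from _       (yes t≤r) _ = t≤r
  from (yes _) (no _)    ()
  from (no _)  (no _)    ()

sumRange-inBand : ∀ M r → r < M → sumRange (ind ∘ inBand r) 0 M ≡ r
sumRange-inBand M r r<M = begin
  sumRange q 0 M                                   ≡⟨ cong (sumRange q 0) (sym (m+[n∸m]≡n r<M)) ⟩
  sumRange q 0 (1 + r + (M ∸ suc r))               ≡⟨ sumRange-++ q 0 (1 + r) _ ⟩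
  q 0 + sumRange q 1 r + sumRange q (1 + r) (M ∸ suc r)
    ≡⟨ cong₂ (λ x y → x + y) (sumRange-ones q 1 r band) (sumRange-zeros q (1 + r) _ above) ⟩
  r + 0                                            ≡⟨ +-identityʳ r ⟩
  r ∎
  where
  open ≡-Reasoning
  q : ℕ → ℕ
  q = ind ∘ inBand r
  band : Within 1 r (λ i → q i ≡ 1)
  band i 1≤i i<1+r = cong ind (inBand-intro 1≤i (s≤s⁻¹ i<1+r))
  above : Within (1 + r) (M ∸ suc r) (λ i → q i ≡ 0)
  above i r<i _ with inBand r i in e
  ... | false = refl
  ... | true  = ⊥-elim (<⇒≱ r<i (inBand⇒≤ r i e))

inTopBand : ℕ → ℕ → ℕ → Bool
inTopBand M r t = does (M ∸ r ≤? t)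

sumRange-inTopBand : ∀ M r → r ≤ M → sumRange (ind ∘ inTopBand M r) 0 M ≡ r
sumRange-inTopBand M r r≤M = begin
  sumRange q 0 M                                   ≡⟨ cong (sumRange q 0) (sym (m∸n+n≡m r≤M)) ⟩
  sumRange q 0 ((M ∸ r) + r)                       ≡⟨ sumRange-++ q 0 (M ∸ r) r ⟩
  sumRange q 0 (M ∸ r) + sumRange q (M ∸ r) r      ≡⟨ cong₂ _+_ (sumRange-zeros q 0 (M ∸ r) below) (sumRange-ones q (M ∸ r) r band) ⟩
  r ∎
  where
  open ≡-Reasoning
  q : ℕ → ℕ
  q = ind ∘ inTopBand M r
  below : Within 0 (M ∸ r) (λ i → q i ≡ 0)
  below i _ i< rewrite dec-false (M ∸ r ≤? i) (<⇒≱ i<) = refl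
  band : Within (M ∸ r) r (λ i → q i ≡ 1)
  band i ≤i _ rewrite dec-true (M ∸ r ≤? i) ≤i = refl

inBand⇒inTopBand : ∀ M r u v → u + v ≡ M → ind (inBand r u) ≤ ind (inTopBand M r v)
inBand⇒inTopBand M r u v u+v≡M with inBand r u in e
... | false = z≤n
... | true rewrite dec-true (M ∸ r ≤? v)
        (subst (λ z → z ∸ r ≤ v) u+v≡M (m≤n+o⇒m∸n≤o (u + v) r (+-monoˡ-≤ v (inBand⇒≤ r u e)))) = ≤-refl

circulantAdj : ℕ → ℕ → ℕ → ℕ → Bool
circulantAdj M r a b = inBand r (clockwise M a b) ∨ inBand r (clockwise M b a)

circulantAdj-sym : ∀ M r a b → circulantAdj M r a b ≡ circulantAdj M r b a
circulantAdj-sym M r a b = ∨-comm (inBand r (clockwise M a b)) (inBand r (clockwise M b a))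

circulantAdj-irrefl : ∀ M r a → circulantAdj M r a a ≡ false
circulantAdj-irrefl M r a rewrite clockwise-self M a = refl

circulantAdj-step : ∀ M .{{_ : NonZero M}} r a d → r < M → a < M → 1 ≤ d → d ≤ r → circulantAdj M r a ((a + d) % M) ≡ true
circulantAdj-step M r a d r<M a<M 1≤d d≤r rewrite clockwise-step M a d a<M (≤-<-trans d≤r r<M) | inBand-intro 1≤d d≤r = refl

circulantAdj-degree : ∀ M .{{_ : NonZero M}} r a → r < M → a < M → sumRange (ind ∘ circulantAdj M r a) 0 M ≤ r + r
circulantAdj-degree M r a r<M a<M = begin
  sumRange (ind ∘ circulantAdj M r a) 0 M
    ≤⟨ sumRange-mono-≤ 0 M (λ b _ _ → ind-∨-≤ (inBand r (clockwise M a b)) (inBand r (clockwise M b a))) ⟩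
  sumRange (λ b → ind (inBand r (clockwise M a b)) + ind (inBand r (clockwise M b a))) 0 M
    ≡⟨ sumRange-distrib-+ _ _ 0 M ⟩
  sumRange (λ b → ind (inBand r (clockwise M a b))) 0 M + sumRange (λ b → ind (inBand r (clockwise M b a))) 0 M
    ≤⟨ +-mono-≤ (≤-reflexive outgoing) incoming ⟩
  r + r ∎
  where
  open ≤-Reasoning
  rotated : ∀ f → sumRange (λ b → f (clockwise M a b)) 0 M ≡ sumRange f 0 M
  rotated f = trans (sumRange-cong 0 M (λ b _ b<M → cong f (clockwise≡rotated M a b a<M b<M)))
                    (sumRange-rotate M f (M ∸ a) (m∸n≤m M a))
  outgoing : sumRange (λ b → ind (inBand r (clockwise M a b))) 0 M ≡ r
  outgoing = trans (rotated (ind ∘ inBand r)) (sumRange-inBand M r r<M)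
  incoming-pointwise : Within 0 M (λ b → ind (inBand r (clockwise M b a)) ≤ ind (inTopBand M r (clockwise M a b)))
  incoming-pointwise b _ b<M with b ≟ a
  ... | yes refl rewrite clockwise-self M b = z≤n
  ... | no  b≢a = inBand⇒inTopBand M r _ _ (clockwise-anti M a<M b<M (b≢a ∘ sym))
  incoming : sumRange (λ b → ind (inBand r (clockwise M b a))) 0 M ≤ r
  incoming = ≤-trans (sumRange-mono-≤ 0 M incoming-pointwise)
    (≤-reflexive (trans (rotated (ind ∘ inTopBand M r)) (sumRange-inTopBand M r (<⇒≤ r<M))))

circulantAdj-degree≤pred : ∀ M r a → a < M → sumRange (ind ∘ circulantAdj M r a) 0 M ≤ M ∸ 1
circulantAdj-degree≤pred M r a a<M =
  sumRange≤pred-length (ind ∘ circulantAdj M r a) 0 M a (λ b _ _ → ind≤1 (circulantAdj M r a b)) z≤n a<M (cong ind (circulantAdj-irrefl M r a))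

-- The indicator of p ∈ S for a vertex given by its number p; it is 0 for p ≥ n.
χ : ∀ {n} → Subset n → ℕ → ℕ
χ {n} S p with p <? n
... | yes p<n = ind (lookup S (fromℕ< p<n))
... | no  _   = 0

χ-toℕ : ∀ {n} (S : Subset n) i → χ S (toℕ i) ≡ ind (lookup S i)
χ-toℕ {n} S i with toℕ i <? n
... | yes i<n = cong (ind ∘ lookup S) (fromℕ<-toℕ i i<n)
... | no  i≮n = ⊥-elim (i≮n (toℕ<n i))

χ≡0⇒∉ : ∀ {n} (S : Subset n) p (p<n : p < n) → χ S p ≡ 0 → fromℕ< p<n ∉ S
χ≡0⇒∉ {n} S p p<n e with p <? n
... | yes q<n = lookup≡false⇒∉ S _ (ind≡0 e)
  where
  ind≡0 : ∀ {b} → ind b ≡ 0 → b ≡ false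
  ind≡0 {false} _ = refl
... | no  p≮n = ⊥-elim (p≮n p<n)

∉⇒χ≡0 : ∀ {n} (S : Subset n) u → u ∉ S → χ S (toℕ u) ≡ 0
∉⇒χ≡0 S u u∉S = trans (χ-toℕ S u) (cong ind (∉⇒lookup≡false S u u∉S))

χ≤1 : ∀ {n} (S : Subset n) p → χ S p ≤ 1
χ≤1 {n} S p with p <? n
... | yes _ = ind≤1 _
... | no  _ = z≤n

∣S∣≡sumRange-χ : ∀ {n} (S : Subset n) → ∣ S ∣ ≡ sumRange (χ S) 0 n
∣S∣≡sumRange-χ {n} S =
  trans (∣S∣≡∑lookup S) (trans (sum-cong-≗ {n} (λ i → sym (χ-toℕ S i))) (∑-toℕ n (χ S)))

fromℕ<-cong : ∀ {n a b} (p : a < n) (q : b < n) → a ≡ b → fromℕ< p ≡ fromℕ< q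
fromℕ<-cong p q refl = refl

graphOn : ∀ n (A : ℕ → ℕ → Bool) → (∀ a b → A a b ≡ A b a) → (∀ a → A a a ≡ false) → Graph n
graphOn n A A-sym A-irrefl = record
  { adj = λ i j → A (toℕ i) (toℕ j) ; sym = λ i j → A-sym _ _ ; irrefl = λ i → A-irrefl _ }

links-graphOn≤ : ∀ n A A-sym A-irrefl D → (∀ a → a < n → sumRange (ind ∘ A a) 0 n ≤ D) →
                 links (graphOn n A A-sym A-irrefl) * 2 ≤ n * D
links-graphOn≤ n A A-sym A-irrefl D deg≤ =
  subst₂ _≤_ (sym (handshake (graphOn n A A-sym A-irrefl))) (∑-const n D)
    (∑-mono-≤ n (λ a → subst (_≤ D) (sym (∑-toℕ n (ind ∘ A (toℕ a)))) (deg≤ (toℕ a) (toℕ<n a))))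

module SequenceWalk {n} (G : Graph n) (S : Subset n) (A : ℕ → ℕ → Bool)
  (A⊆G : ∀ i j → A (toℕ i) (toℕ j) ≡ true → adj G i j ≡ true)
  (V : ℕ → ℕ) (V<n : ∀ s → V s < n) (r : ℕ)
  (jump : ∀ s d → 1 ≤ d → d ≤ r → A (V s) (V (s + d)) ≡ true) where

  vertex : ℕ → Fin n
  vertex s = fromℕ< (V<n s)

  Free : ℕ → Set
  Free s = χ S (V s) ≡ 0

  removedBetween : ℕ → ℕ → ℕ
  removedBetween a m = sumRange (χ S ∘ V) (suc a) (pred m)

  private
    hop : ∀ a d → 1 ≤ d → d ≤ r → Free a → Free (a + d) → Reach G S (vertex a) (vertex (a + d))
    hop a d 1≤d d≤r free-a free-a+d = reach-edge G S (χ≡0⇒∉ S _ (V<n a) free-a) (χ≡0⇒∉ S _ (V<n (a + d)) free-a+d)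
      (A⊆G _ _ (subst₂ (λ x y → A x y ≡ true) (sym (toℕ-fromℕ< (V<n a))) (sym (toℕ-fromℕ< (V<n (a + d))))
        (jump a d 1≤d d≤r)))

    Walk : ℕ → Set
    Walk m = ∀ a → Free a → Free (a + m) → removedBetween a m < r → Reach G S (vertex a) (vertex (a + m))

  -- Among the r positions after a some position a + t is free, since fewer than r of them are removed.
  walk : ∀ m → Walk m
  walk = <-rec Walk extend
    where
    extend : ∀ m → (∀ {m′} → m′ < m → Walk m′) → Walk m
    extend zero    _ a free-a _ _ = subst (λ z → Reach G S (vertex a) (vertex z)) (sym (+-identityʳ a)) (here (χ≡0⇒∉ S _ (V<n a) free-a))
    extend (suc m) shorter a free-a free-end few with suc m ≤? r
    ... | yes m<r = hop a (suc m) (s≤s z≤n) m<r free-a free-end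
    ... | no  m≮r = subst (λ z → Reach G S (vertex a) (vertex z)) a+t+rest≡a+m
                      (reach-trans G S (hop a t 1≤t t≤r free-a free-a+t) (shorter rest<m (a + t) free-a+t free-rest few-rest))
      where
      r≤m : r ≤ m
      r≤m = ≤-pred (≰⇒> m≮r)
      free-in-window : ∃ λ i → suc a ≤ i × i < suc a + r × Free i
      free-in-window = sumRange<length⇒zero (χ S ∘ V) (suc a) r
        (≤-<-trans (sumRange-subrange (χ S ∘ V) (suc a) m (suc a) r ≤-refl (+-monoʳ-≤ (suc a) r≤m)) few)
      t : ℕ
      t = proj₁ free-in-window ∸ a
      a+t≡i : a + t ≡ proj₁ free-in-window
      a+t≡i = m+[n∸m]≡n (≤-trans (n≤1+n a) (proj₁ (proj₂ free-in-window)))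
      1≤t : 1 ≤ t
      1≤t = m<n⇒0<n∸m (proj₁ (proj₂ free-in-window))
      t≤r : t ≤ r
      t≤r = +-cancelˡ-≤ a _ _ (subst (_≤ a + r) (sym a+t≡i) (≤-pred (proj₁ (proj₂ (proj₂ free-in-window)))))
      free-a+t : Free (a + t)
      free-a+t = subst Free (sym a+t≡i) (proj₂ (proj₂ (proj₂ free-in-window)))
      rest : ℕ
      rest = m ∸ t
      t+rest≡m : t + rest ≡ m
      t+rest≡m = m+[n∸m]≡n (≤-trans t≤r r≤m)
      a+t+rest≡a+m : a + t + suc rest ≡ a + suc m
      a+t+rest≡a+m = trans (+-assoc a t (suc rest)) (cong (a +_) (trans (+-suc t rest) (cong suc t+rest≡m)))
      rest<m : suc rest < suc m
      rest<m = s≤s (subst (suc rest ≤_) t+rest≡m (+-monoˡ-≤ rest 1≤t))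
      free-rest : Free (a + t + suc rest)
      free-rest = subst Free (sym a+t+rest≡a+m) free-end
      few-rest : removedBetween (a + t) (suc rest) < r
      few-rest = ≤-<-trans (sumRange-subrange (χ S ∘ V) (suc a) m (suc (a + t)) rest (s≤s (m≤m+n a t))
                   (s≤s (≤-reflexive (trans (+-assoc a t rest) (cong (a +_) t+rest≡m))))) few

at-most-one-below : ∀ a b r → a + b < r + r → a < r ⊎ b < r
at-most-one-below a b r a+b<2r with a <? r | b <? r
... | yes a<r | _       = inj₁ a<r
... | no  _   | yes b<r = inj₂ b<r
... | no  a≮r | no  b≮r = ⊥-elim (<⇒≱ a+b<2r (+-mono-≤ (≮⇒≥ a≮r) (≮⇒≥ b≮r)))

m+n≡o⇒o≤m⇒n≡0 : ∀ m {n o} → m + n ≡ o → o ≤ m → n ≡ 0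
m+n≡o⇒o≤m⇒n≡0 m {n} m+n≡o o≤m =
  n≤0⇒n≡0 (+-cancelˡ-≤ m n 0 (≤-trans (≤-reflexive m+n≡o) (≤-trans o≤m (≤-reflexive (sym (+-identityʳ m))))))

module CirculantBlock {n} (G : Graph n) (S : Subset n) (A : ℕ → ℕ → Bool)
  (A⊆G : ∀ i j → A (toℕ i) (toℕ j) ≡ true → adj G i j ≡ true)
  (o M : ℕ) .{{_ : NonZero M}} (r : ℕ) (r<M : r < M) (o+M≤n : o + M ≤ n)
  (circulantAdj⊆A : ∀ X Y → X < M → Y < M → circulantAdj M r X Y ≡ true → A (o + X) (o + Y) ≡ true) where

  in-block : ∀ {X} → X < M → o + X < n
  in-block X<M = ≤-trans (+-monoʳ-< o X<M) o+M≤n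

  module Around {X} (X<M : X < M) where

    V : ℕ → ℕ
    V s = o + (X + s) % M

    V<n : ∀ s → V s < n
    V<n s = in-block (m%n<n (X + s) M)

    jump : ∀ s d → 1 ≤ d → d ≤ r → A (V s) (V (s + d)) ≡ true
    jump s d 1≤d d≤r = subst (λ z → A (V s) (o + z) ≡ true)
      (trans (sym ([m+n]%o≡[m%o+n]%o (X + s) d M)) (cong (_% M) (+-assoc X s d)))
      (circulantAdj⊆A _ _ (m%n<n (X + s) M) (m%n<n _ M) (circulantAdj-step M r ((X + s) % M) d r<M (m%n<n (X + s) M) 1≤d d≤r))

    open SequenceWalk G S A A⊆G V V<n r jump public

    V0≡X : V 0 ≡ o + X
    V0≡X = cong (o +_) (trans (cong (_% M) (+-identityʳ X)) (m<n⇒m%n≡m X<M))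

    VM≡X : V M ≡ o + X
    VM≡X = cong (o +_) (trans ([m+n]%n≡m%n X M) (m<n⇒m%n≡m X<M))

    removedAround : sumRange (χ S ∘ V) 0 M ≡ sumRange (χ S) o M
    removedAround = trans (sumRange-rotate M (λ j → χ S (o + j)) X (<⇒≤ X<M)) (sym (sumRange-from-0 (χ S) o M))

  -- Y splits the circle into two arcs, and one of them has fewer than r removed vertices.
  connected : sumRange (χ S) o M < r + r → ∀ X Y (X<M : X < M) (Y<M : Y < M) →
              χ S (o + X) ≡ 0 → χ S (o + Y) ≡ 0 → Reach G S (fromℕ< (in-block X<M)) (fromℕ< (in-block Y<M))
  connected few X Y X<M Y<M free-X free-Y with X ≟ Y
  ... | yes refl = here (χ≡0⇒∉ S _ (in-block X<M) free-X)
  ... | no  X≢Y  = along-arc (at-most-one-below (arc 1 (pred L)) (arc (suc L) (M ∸ suc L)) r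
                     (subst (_< r + r) (trans (sym removedAround) arcs) few))
    where
    open Around X<M
    arc : ℕ → ℕ → ℕ
    arc = sumRange (χ S ∘ V)
    L : ℕ
    L = clockwise M X Y
    L≡1+pred : L ≡ suc (pred L)
    L≡1+pred = sym (suc-pred L {{>-nonZero (clockwise-pos M X<M X≢Y)}})
    VL≡Y : V L ≡ o + Y
    VL≡Y = cong (o +_) (clockwise-target M X Y X<M Y<M)
    free-0 : Free 0
    free-0 = trans (cong (χ S) V0≡X) free-X
    free-L : Free L
    free-L = trans (cong (χ S) VL≡Y) free-Y
    L+rest≡M : L + suc (M ∸ suc L) ≡ M
    L+rest≡M = trans (+-suc L _) (m+[n∸m]≡n (clockwise<M M X<M Y<M))
    arcs : arc 0 M ≡ arc 1 (pred L) + arc (suc L) (M ∸ suc L)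
    arcs = begin
      arc 0 M                                                    ≡⟨ cong (arc 0) (sym L+rest≡M) ⟩
      arc 0 (L + suc (M ∸ suc L))                                ≡⟨ sumRange-++ (χ S ∘ V) 0 L _ ⟩
      arc 0 L + (χ S (V L) + arc (suc L) (M ∸ suc L))
        ≡⟨ cong (λ z → arc 0 z + (χ S (V L) + arc (suc L) (M ∸ suc L))) L≡1+pred ⟩
      χ S (V 0) + arc 1 (pred L) + (χ S (V L) + arc (suc L) (M ∸ suc L))
        ≡⟨ cong₂ (λ a b → a + arc 1 (pred L) + (b + arc (suc L) (M ∸ suc L))) free-0 free-L ⟩
      arc 1 (pred L) + arc (suc L) (M ∸ suc L) ∎
      where open ≡-Reasoning
    vertex-X : ∀ {s} → V s ≡ o + X → vertex s ≡ fromℕ< (in-block X<M)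
    vertex-X {s} = fromℕ<-cong (V<n s) (in-block X<M)
    vertex-Y : ∀ {s} → V s ≡ o + Y → vertex s ≡ fromℕ< (in-block Y<M)
    vertex-Y {s} = fromℕ<-cong (V<n s) (in-block Y<M)
    along-arc : arc 1 (pred L) < r ⊎ arc (suc L) (M ∸ suc L) < r → Reach G S (fromℕ< (in-block X<M)) (fromℕ< (in-block Y<M))
    along-arc (inj₁ few-before) = subst₂ (Reach G S) (vertex-X V0≡X) (vertex-Y (trans (cong V (sym L≡1+pred)) VL≡Y))
      (walk (suc (pred L)) 0 free-0 (subst Free L≡1+pred free-L) few-before)
    along-arc (inj₂ few-after) = reach-sym G S (subst₂ (Reach G S) (vertex-Y VL≡Y) (vertex-X (trans (cong V L+rest≡M) VM≡X))
      (walk (suc (M ∸ suc L)) L free-L (trans (cong (χ S ∘ V) L+rest≡M) (trans (cong (χ S) VM≡X) free-X)) few-after))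

module Prism (h : ℕ) .{{_ : NonZero h}} (r : ℕ) (r<h : r < h) (twisted : Bool) where

  n : ℕ
  n = h + h

  lower : ℕ → Bool
  lower a = does (a <? h)

  pos : ℕ → ℕ
  pos a = if lower a then a else a ∸ h

  sameLayer : ℕ → ℕ → Bool
  sameLayer a b = not (lower a xor lower b)

  layerAdj : ℕ → ℕ → Bool
  layerAdj a b = sameLayer a b ∧ circulantAdj h r (pos a) (pos b)

  rung : ℕ → ℕ → Bool
  rung a b = does (a + h ≟ b) ∨ does (b + h ≟ a)

  twist : ℕ → ℕ → Bool
  twist a b = lower a ∧ does (b ≟ h + suc a % h)

  twistAdj : ℕ → ℕ → Bool
  twistAdj a b = twisted ∧ (twist a b ∨ twist b a)

  prismAdj : ℕ → ℕ → Bool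
  prismAdj a b = (layerAdj a b ∨ rung a b) ∨ twistAdj a b

  prismAdj-sym : ∀ a b → prismAdj a b ≡ prismAdj b a
  prismAdj-sym a b = cong₂ _∨_
    (cong₂ _∨_ (cong₂ _∧_ (cong not (xor-comm (lower a) (lower b))) (circulantAdj-sym h r (pos a) (pos b)))
               (∨-comm (does (a + h ≟ b)) (does (b + h ≟ a))))
    (cong (twisted ∧_) (∨-comm (twist a b) (twist b a)))

  rung-irrefl : ∀ a → rung a a ≡ false
  rung-irrefl a rewrite dec-false (a + h ≟ a) (λ e → m+1+n≢m a (trans (cong (a +_) (suc-pred h)) e)) = refl

  twist-irrefl : ∀ a → twist a a ≡ false
  twist-irrefl a with a <? h
  ... | no  a≮h rewrite dec-false (a <? h) a≮h = refl
  ... | yes a<h rewrite dec-true (a <? h) a<h | dec-false (a ≟ h + suc a % h) (λ e → <⇒≱ a<h (≤-trans (m≤m+n h _) (≤-reflexive (sym e)))) = refl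

  prismAdj-irrefl : ∀ a → prismAdj a a ≡ false
  prismAdj-irrefl a rewrite xor-same (lower a) | circulantAdj-irrefl h r (pos a) | rung-irrefl a | twist-irrefl a = ∧-zeroʳ twisted

  graph : Graph n
  graph = graphOn n prismAdj prismAdj-sym prismAdj-irrefl

  lower-intro : ∀ {X} → X < h → lower X ≡ true
  lower-intro X<h = dec-true (_ <? h) X<h

  upper-intro : ∀ {a} → h ≤ a → lower a ≡ false
  upper-intro h≤a = dec-false (_ <? h) (≤⇒≯ h≤a)

  lower-adj : ∀ X Y → X < h → Y < h → circulantAdj h r X Y ≡ true → prismAdj X Y ≡ true
  lower-adj X Y X<h Y<h e rewrite lower-intro X<h | lower-intro Y<h | e = refl

  upper-adj : ∀ X Y → circulantAdj h r X Y ≡ true → prismAdj (h + X) (h + Y) ≡ true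
  upper-adj X Y e rewrite upper-intro (m≤m+n h X) | upper-intro (m≤m+n h Y) | m+n∸m≡n h X | m+n∸m≡n h Y | e = refl

  rung-adj : ∀ X → prismAdj X (h + X) ≡ true
  rung-adj X rewrite dec-true (X + h ≟ h + X) (+-comm X h) | ∨-zeroʳ (layerAdj X (h + X)) = refl

  twist-adj : twisted ≡ true → ∀ X → X < h → prismAdj X (h + suc X % h) ≡ true
  twist-adj refl X X<h rewrite lower-intro X<h | dec-true (h + suc X % h ≟ h + suc X % h) refl = ∨-zeroʳ _

  rung-cases : ∀ {a b} → rung a b ≡ true → a + h ≡ b ⊎ b + h ≡ a
  rung-cases {a} {b} = does-∨ (a + h ≟ b) (b + h ≟ a)

  twist-cases : ∀ a b → twist a b ≡ true → a < h × b ≡ h + suc a % h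
  twist-cases a b = does-∧ (a <? h) (b ≟ h + suc a % h)

  suc%-injective : ∀ {a b} → a < h → b < h → suc a % h ≡ suc b % h → a ≡ b
  suc%-injective {a} {b} a<h b<h e with suc a <? h | suc b <? h
  ... | yes sa<h | yes sb<h = suc-injective (trans (sym (m<n⇒m%n≡m sa<h)) (trans e (m<n⇒m%n≡m sb<h)))
  ... | no  sa≮h | no  sb≮h = suc-injective (trans (≤-antisym a<h (≮⇒≥ sa≮h)) (sym (≤-antisym b<h (≮⇒≥ sb≮h))))
  ... | yes sa<h | no  sb≮h with () ← trans (sym (m<n⇒m%n≡m sa<h)) (trans e (trans (cong (_% h) (≤-antisym b<h (≮⇒≥ sb≮h))) (n%n≡0 h)))
  ... | no  sa≮h | yes sb<h with () ← trans (sym (m<n⇒m%n≡m sb<h)) (trans (sym e) (trans (cong (_% h) (≤-antisym a<h (≮⇒≥ sa≮h))) (n%n≡0 h)))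

  module _ (D : ℕ) (layer-degree≤ : ∀ X → X < h → sumRange (ind ∘ circulantAdj h r X) 0 h ≤ D) where

    layerAdj-degree≤ : ∀ a → a < n → sumRange (ind ∘ layerAdj a) 0 n ≤ D
    layerAdj-degree≤ a a<n with a <? h
    ... | yes a<h = begin
      sumRange (ind ∘ layerAdj a) 0 n                           ≡⟨ sumRange-++ (ind ∘ layerAdj a) 0 h h ⟩
      sumRange (ind ∘ layerAdj a) 0 h + sumRange (ind ∘ layerAdj a) h h
        ≡⟨ cong₂ _+_ (sumRange-cong 0 h same) (sumRange-zeros (ind ∘ layerAdj a) h h other) ⟩
      sumRange (ind ∘ circulantAdj h r a) 0 h + 0                       ≡⟨ +-identityʳ _ ⟩
      sumRange (ind ∘ circulantAdj h r a) 0 h                           ≤⟨ layer-degree≤ a a<h ⟩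
      D ∎
      where
      open ≤-Reasoning
      same : Within 0 h (λ b → ind (layerAdj a b) ≡ ind (circulantAdj h r a b))
      same b _ b<h rewrite lower-intro a<h | lower-intro b<h = refl
      other : Within h h (λ b → ind (layerAdj a b) ≡ 0)
      other b h≤b _ rewrite lower-intro a<h | upper-intro h≤b = refl
    ... | no a≮h = begin
      sumRange (ind ∘ layerAdj a) 0 n                           ≡⟨ sumRange-++ (ind ∘ layerAdj a) 0 h h ⟩
      sumRange (ind ∘ layerAdj a) 0 h + sumRange (ind ∘ layerAdj a) h h
        ≡⟨ cong₂ _+_ (sumRange-zeros (ind ∘ layerAdj a) 0 h other) (sumRange-from-0 (ind ∘ layerAdj a) h h) ⟩
      sumRange (λ y → ind (layerAdj a (h + y))) 0 h             ≡⟨ sumRange-cong 0 h same ⟩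
      sumRange (ind ∘ circulantAdj h r (a ∸ h)) 0 h                     ≤⟨ layer-degree≤ (a ∸ h) a∸h<h ⟩
      D ∎
      where
      open ≤-Reasoning
      h≤a : h ≤ a
      h≤a = ≮⇒≥ a≮h
      a∸h<h : a ∸ h < h
      a∸h<h = +-cancelʳ-< h _ h (subst (_< h + h) (sym (m∸n+n≡m h≤a)) a<n)
      other : Within 0 h (λ b → ind (layerAdj a b) ≡ 0)
      other b _ b<h rewrite upper-intro h≤a | lower-intro b<h = refl
      same : Within 0 h (λ y → ind (layerAdj a (h + y)) ≡ ind (circulantAdj h r (a ∸ h) y))
      same y _ _ rewrite upper-intro h≤a | upper-intro (m≤m+n h y) | m+n∸m≡n h y = refl

    rung-degree≤ : ∀ a → sumRange (ind ∘ rung a) 0 n ≤ 1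
    rung-degree≤ a = sumRange-ind-unique (rung a) 0 n unique
      where
      unique : Within 0 n (λ i → Within 0 n (λ j → rung a i ≡ true → rung a j ≡ true → i ≡ j))
      unique i _ i<n j _ j<n ei ej with rung-cases ei | rung-cases ej
      ... | inj₁ a+h≡i | inj₁ a+h≡j = trans (sym a+h≡i) a+h≡j
      ... | inj₂ i+h≡a | inj₂ j+h≡a = +-cancelʳ-≡ h i j (trans i+h≡a (sym j+h≡a))
      ... | inj₁ a+h≡i | inj₂ j+h≡a = ⊥-elim (<⇒≱ i<n (subst (h + h ≤_) a+h≡i (+-monoˡ-≤ h (subst (h ≤_) j+h≡a (m≤n+m h j)))))
      ... | inj₂ i+h≡a | inj₁ a+h≡j = ⊥-elim (<⇒≱ j<n (subst (h + h ≤_) a+h≡j (+-monoˡ-≤ h (subst (h ≤_) i+h≡a (m≤n+m h i)))))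

    twistAdj-degree≤ : ∀ a → sumRange (ind ∘ twistAdj a) 0 n ≤ ind twisted
    twistAdj-degree≤ a = by-flag twisted
      where
      lower≢upper : ∀ {x y} → x < h → x ≡ h + y → ⊥
      lower≢upper x<h x≡ = <⇒≱ x<h (≤-trans (m≤m+n h _) (≤-reflexive (sym x≡)))
      unique : Within 0 n (λ i → Within 0 n (λ j → twist a i ∨ twist i a ≡ true → twist a j ∨ twist j a ≡ true → i ≡ j))
      unique i _ _ j _ _ ei ej with twist a i in ai | twist i a in ia | twist a j in aj | twist j a in ja
      ... | true | _ | true | _ = trans (proj₂ (twist-cases a i ai)) (sym (proj₂ (twist-cases a j aj)))
      ... | true | _ | false | true = ⊥-elim (lower≢upper (proj₁ (twist-cases a i ai)) (proj₂ (twist-cases j a ja)))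
      ... | false | true | true | _ = ⊥-elim (lower≢upper (proj₁ (twist-cases a j aj)) (proj₂ (twist-cases i a ia)))
      ... | false | true | false | true = suc%-injective (proj₁ (twist-cases i a ia)) (proj₁ (twist-cases j a ja))
        (+-cancelˡ-≡ h _ _ (trans (sym (proj₂ (twist-cases i a ia))) (proj₂ (twist-cases j a ja))))
      by-flag : ∀ t → sumRange (λ b → ind (t ∧ (twist a b ∨ twist b a))) 0 n ≤ ind t
      by-flag false = ≤-reflexive (sumRange-zeros _ 0 n (λ _ _ _ → refl))
      by-flag true  = sumRange-ind-unique (λ b → twist a b ∨ twist b a) 0 n unique

    prism-degree≤ : ∀ a → a < n → sumRange (ind ∘ prismAdj a) 0 n ≤ D + 1 + ind twisted
    prism-degree≤ a a<n = begin
      sumRange (ind ∘ prismAdj a) 0 n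
        ≤⟨ sumRange-mono-≤ 0 n (λ b _ _ → three-way (layerAdj a b) (rung a b) (twistAdj a b)) ⟩
      sumRange (λ b → ind (layerAdj a b) + ind (rung a b) + ind (twistAdj a b)) 0 n
        ≡⟨ sumRange-distrib-+ (λ b → ind (layerAdj a b) + ind (rung a b)) (ind ∘ twistAdj a) 0 n ⟩
      sumRange (λ b → ind (layerAdj a b) + ind (rung a b)) 0 n + sumRange (ind ∘ twistAdj a) 0 n
        ≡⟨ cong (_+ sumRange (ind ∘ twistAdj a) 0 n) (sumRange-distrib-+ (ind ∘ layerAdj a) (ind ∘ rung a) 0 n) ⟩
      sumRange (ind ∘ layerAdj a) 0 n + sumRange (ind ∘ rung a) 0 n + sumRange (ind ∘ twistAdj a) 0 n
        ≤⟨ +-mono-≤ (+-mono-≤ (layerAdj-degree≤ a a<n) (rung-degree≤ a)) (twistAdj-degree≤ a) ⟩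
      D + 1 + ind twisted ∎
      where
      open ≤-Reasoning
      three-way : ∀ x y z → ind ((x ∨ y) ∨ z) ≤ ind x + ind y + ind z
      three-way x y z = ≤-trans (ind-∨-≤ (x ∨ y) z) (+-monoˡ-≤ (ind z) (ind-∨-≤ x y))

    links≤ : links graph * 2 ≤ n * (D + 1 + ind twisted)
    links≤ = links-graphOn≤ n prismAdj prismAdj-sym prismAdj-irrefl (D + 1 + ind twisted) prism-degree≤

  lowerRemoved : Subset n → ℕ
  lowerRemoved S = sumRange (χ S) 0 h

  upperRemoved : Subset n → ℕ
  upperRemoved S = sumRange (χ S) h h

  CrossEdge : Set
  CrossEdge = ∀ S → lowerRemoved S < r + r → upperRemoved S < r + r → lowerRemoved S + upperRemoved S ≡ r + r →
    Σ ℕ λ x → Σ ℕ λ y → x < h × y < h × χ S x ≡ 0 × χ S (h + y) ≡ 0 × prismAdj x (h + y) ≡ true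

  module Robustness (1≤r : 1 ≤ r) (cross : CrossEdge) (S : Subset n) where

    module L = CirculantBlock graph S prismAdj (λ _ _ e → e) 0 h r r<h (m≤m+n h h) lower-adj
    module U = CirculantBlock graph S prismAdj (λ _ _ e → e) h h r r<h ≤-refl (λ X Y _ _ → upper-adj X Y)

    lowerV : ∀ {X} → X < h → Fin n
    lowerV X<h = fromℕ< (L.in-block X<h)

    upperV : ∀ {Y} → Y < h → Fin n
    upperV Y<h = fromℕ< (U.in-block Y<h)

    Free : ℕ → Set
    Free p = χ S p ≡ 0

    ∉⇒Free : ∀ {p} (p<n : p < n) → fromℕ< p<n ∉ S → Free p
    ∉⇒Free p<n p∉S = trans (cong (χ S) (sym (toℕ-fromℕ< p<n))) (∉⇒χ≡0 S _ p∉S)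

    edge : ∀ {p q} (p<n : p < n) (q<n : q < n) → Free p → Free q → prismAdj p q ≡ true →
           Reach graph S (fromℕ< p<n) (fromℕ< q<n)
    edge p<n q<n free-p free-q e = reach-edge graph S (χ≡0⇒∉ S _ p<n free-p) (χ≡0⇒∉ S _ q<n free-q)
      (subst₂ (λ x y → prismAdj x y ≡ true) (sym (toℕ-fromℕ< p<n)) (sym (toℕ-fromℕ< q<n)) e)

    vertex-cases : ∀ (w : Fin n) → (Σ ℕ λ X → Σ (X < h) λ X<h → w ≡ lowerV X<h) ⊎ (Σ ℕ λ Y → Σ (Y < h) λ Y<h → w ≡ upperV Y<h)
    vertex-cases w with toℕ w <? h
    ... | yes w<h = inj₁ (toℕ w , w<h , toℕ-injective (sym (toℕ-fromℕ< _)))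
    ... | no  w≮h = inj₂ (toℕ w ∸ h , w∸h<h , toℕ-injective (trans (sym (m+[n∸m]≡n h≤w)) (sym (toℕ-fromℕ< _))))
      where
      h≤w : h ≤ toℕ w
      h≤w = ≮⇒≥ w≮h
      w∸h<h : toℕ w ∸ h < h
      w∸h<h = +-cancelʳ-< h _ h (subst (_< h + h) (sym (m∸n+n≡m h≤w)) (toℕ<n w))

    Hub : Set
    Hub = Σ (Fin n) λ hub → ∀ w → w ∉ S → Reach graph S w hub

    hub-across : lowerRemoved S < r + r → upperRemoved S < r + r → lowerRemoved S + upperRemoved S ≡ r + r → Hub
    hub-across few-L few-U total with cross S few-L few-U total
    ... | x , y , x<h , y<h , free-x , free-y , x~y = lowerV x<h , to-hub
      where
      to-hub : ∀ w → w ∉ S → Reach graph S w (lowerV x<h)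
      to-hub w w∉S with vertex-cases w
      ... | inj₁ (X , X<h , refl) = L.connected few-L X x X<h x<h (∉⇒Free (L.in-block X<h) w∉S) free-x
      ... | inj₂ (Y , Y<h , refl) = reach-trans graph S (U.connected few-U Y y Y<h y<h (∉⇒Free (U.in-block Y<h) w∉S) free-y)
                                      (edge (U.in-block y<h) (L.in-block x<h) free-y free-x (trans (prismAdj-sym (h + y) x) x~y))

    hub-upper : upperRemoved S ≡ 0 → Hub
    hub-upper none-U = upperV h>0 , to-hub
      where
      h>0 : 0 < h
      h>0 = >-nonZero⁻¹ h
      few-U : upperRemoved S < r + r
      few-U = subst (_< r + r) (sym none-U) (≤-trans 1≤r (m≤m+n r r))
      free-U : ∀ Y → Y < h → Free (h + Y)
      free-U Y Y<h = sumRange≡0⇒zero (χ S) h h none-U (h + Y) (m≤m+n h Y) (+-monoʳ-< h Y<h)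
      to-hub : ∀ w → w ∉ S → Reach graph S w (upperV h>0)
      to-hub w w∉S with vertex-cases w
      ... | inj₂ (Y , Y<h , refl) = U.connected few-U Y 0 Y<h h>0 (∉⇒Free (U.in-block Y<h) w∉S) (free-U 0 h>0)
      ... | inj₁ (X , X<h , refl) = reach-trans graph S
                                      (edge (L.in-block X<h) (U.in-block X<h) (∉⇒Free (L.in-block X<h) w∉S) (free-U X X<h) (rung-adj X))
                                      (U.connected few-U X 0 X<h h>0 (free-U X X<h) (free-U 0 h>0))

    hub-lower : lowerRemoved S ≡ 0 → Hub
    hub-lower none-L = lowerV h>0 , to-hub
      where
      h>0 : 0 < h
      h>0 = >-nonZero⁻¹ h
      few-L : lowerRemoved S < r + r
      few-L = subst (_< r + r) (sym none-L) (≤-trans 1≤r (m≤m+n r r))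
      free-L : ∀ X → X < h → Free X
      free-L X X<h = sumRange≡0⇒zero (χ S) 0 h none-L X z≤n X<h
      to-hub : ∀ w → w ∉ S → Reach graph S w (lowerV h>0)
      to-hub w w∉S with vertex-cases w
      ... | inj₁ (X , X<h , refl) = L.connected few-L X 0 X<h h>0 (∉⇒Free (L.in-block X<h) w∉S) (free-L 0 h>0)
      ... | inj₂ (Y , Y<h , refl) = reach-trans graph S
                                      (edge (U.in-block Y<h) (L.in-block Y<h) (∉⇒Free (U.in-block Y<h) w∉S) (free-L Y Y<h) (trans (prismAdj-sym (h + Y) Y) (rung-adj Y)))
                                      (L.connected few-L Y 0 Y<h h>0 (free-L Y Y<h) (free-L 0 h>0))

    -- A layer holding all r + r removed vertices leaves the other layer intact.
    hub : lowerRemoved S + upperRemoved S ≡ r + r → Hub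
    hub total with lowerRemoved S <? r + r | upperRemoved S <? r + r
    ... | yes few-L  | yes few-U = hub-across few-L few-U total
    ... | no  many-L | _         = hub-upper (m+n≡o⇒o≤m⇒n≡0 (lowerRemoved S) total (≮⇒≥ many-L))
    ... | yes _      | no many-U = hub-lower (m+n≡o⇒o≤m⇒n≡0 (upperRemoved S) (trans (+-comm (upperRemoved S) _) total) (≮⇒≥ many-U))

  robust : 1 ≤ r → CrossEdge → Robust (r + r) graph
  robust 1≤r cross S ∣S∣≡2r = hub⇒connected graph S (proj₁ hub) (proj₂ hub)
    where
    open Robustness 1≤r cross S using (Hub) renaming (hub to find-hub)
    hub : Hub
    hub = find-hub (trans (sym (sumRange-++ (χ S) 0 h h)) (trans (sym (∣S∣≡sumRange-χ S)) ∣S∣≡2r))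

  private
    upper-from-0 : ∀ S → sumRange (λ y → χ S (h + y)) 0 h ≡ upperRemoved S
    upper-from-0 S = sym (sumRange-from-0 (χ S) h h)

  rung-cross : r + r < h → CrossEdge
  rung-cross 2r<h S _ _ total with sumRange<length⇒zero (λ x → χ S x + χ S (h + x)) 0 h pairs<h
    where
    pairs<h : sumRange (λ x → χ S x + χ S (h + x)) 0 h < h
    pairs<h = subst (_< h) (sym (trans (sumRange-distrib-+ (χ S) (λ x → χ S (h + x)) 0 h)
                (trans (cong (lowerRemoved S +_) (upper-from-0 S)) total))) 2r<h
  ... | x , _ , x<h , both-free =
    x , x , x<h , x<h , m+n≡0⇒m≡0 (χ S x) both-free , m+n≡0⇒n≡0 (χ S x) both-free , rung-adj x

  -- If no free lower vertex x has a free partner h + x or h + (x + 1) mod h, each of these pairs holds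
  -- exactly one of the h removed vertices, so the upper layer is entirely removed or entirely free.
  module NoFreePartner (S : Subset n) (2r≡h : r + r ≡ h) (total : lowerRemoved S + upperRemoved S ≡ r + r)
    (none : ¬ (∃ λ x → x < h × χ S x ≡ 0 × (χ S (h + x) ≡ 0 ⊎ χ S (h + suc x % h) ≡ 0))) where

    private
      s : ℕ → ℕ
      s = χ S

      one-of : ∀ {a b} → ¬ (a ≡ 0 × b ≡ 0) → 1 ≤ a + b
      one-of {zero}  {zero}  both = ⊥-elim (both (refl , refl))
      one-of {zero}  {suc b} _    = s≤s z≤n
      one-of {suc a}         _    = s≤s z≤n

      exactly-one : ∀ (g : ℕ → ℕ) → sumRange g 0 h ≡ upperRemoved S →
                    Within 0 h (λ x → 1 ≤ s x + g x) → Within 0 h (λ x → s x + g x ≡ 1)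
      exactly-one g g-sum ≥1 = sumRange-tight (λ x → s x + g x) 0 h ≥1 (≤-reflexive (begin
        sumRange (λ x → s x + g x) 0 h         ≡⟨ sumRange-distrib-+ s g 0 h ⟩
        lowerRemoved S + sumRange g 0 h        ≡⟨ cong (lowerRemoved S +_) g-sum ⟩
        lowerRemoved S + upperRemoved S        ≡⟨ trans total 2r≡h ⟩
        h ∎))
        where open ≡-Reasoning

      straight : Within 0 h (λ x → s x + s (h + x) ≡ 1)
      straight = exactly-one (λ x → s (h + x)) (upper-from-0 S)
        (λ x _ x<h → one-of (λ (free-x , free-h+x) → none (x , x<h , free-x , inj₁ free-h+x)))

      shifted : Within 0 h (λ x → s x + s (h + suc x % h) ≡ 1)
      shifted = exactly-one (λ x → s (h + suc x % h))
        (trans (sumRange-rotate h (λ y → s (h + y)) 1 (>-nonZero⁻¹ h)) (upper-from-0 S))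
        (λ x _ x<h → one-of (λ (free-x , free-next) → none (x , x<h , free-x , inj₂ free-next)))

      next-equal : ∀ x → x < h → s (h + x) ≡ s (h + suc x % h)
      next-equal x x<h = +-cancelˡ-≡ (s x) _ _ (trans (straight x z≤n x<h) (sym (shifted x z≤n x<h)))

      constant : ∀ y → y < h → s (h + y) ≡ s (h + 0)
      constant zero    _   = refl
      constant (suc y) y<h = trans (cong (λ z → s (h + z)) (sym (m<n⇒m%n≡m y<h)))
        (trans (sym (next-equal y (≤-trans (n≤1+n _) y<h))) (constant y (≤-trans (n≤1+n _) y<h)))

    upperRemoved≡ : upperRemoved S ≡ h * χ S (h + 0)
    upperRemoved≡ = trans (sym (upper-from-0 S))
      (trans (sumRange-cong 0 h (λ y _ y<h → constant y y<h)) (sumRange-const _ 0 h))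

  twisted-cross : twisted ≡ true → r + r ≡ h → CrossEdge
  twisted-cross tw 2r≡h S few-L few-U total
    with anyUpTo? (λ x → (χ S x ≟ 0) ×-dec ((χ S (h + x) ≟ 0) ⊎-dec (χ S (h + suc x % h) ≟ 0))) h
  ... | yes (x , x<h , free-x , inj₁ free-h+x) = x , x , x<h , x<h , free-x , free-h+x , rung-adj x
  ... | yes (x , x<h , free-x , inj₂ free-next) = x , suc x % h , x<h , m%n<n (suc x) h , free-x , free-next , twist-adj tw x x<h
  ... | no  none = ⊥-elim (uniform (χ S (h + 0)) refl (χ≤1 S (h + 0)))
    where
    open NoFreePartner S 2r≡h total none
    uniform : ∀ b → χ S (h + 0) ≡ b → b ≤ 1 → ⊥
    uniform zero e _ = <-irrefl (trans (sym (+-identityʳ _)) (trans (cong (lowerRemoved S +_) (sym upper≡0)) total)) few-L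
      where
      upper≡0 : upperRemoved S ≡ 0
      upper≡0 = trans upperRemoved≡ (trans (cong (h *_) e) (*-zeroʳ h))
    uniform (suc zero) e _ = <-irrefl (trans upperRemoved≡ (trans (cong (h *_) e) (trans (*-identityʳ h) (sym 2r≡h)))) few-U
    uniform (suc (suc _)) _ (s≤s ())

module Circulant (n : ℕ) .{{_ : NonZero n}} (r : ℕ) (1≤r : 1 ≤ r) (r<n : r < n) where

  graph : Graph n
  graph = graphOn n (circulantAdj n r) (circulantAdj-sym n r) (circulantAdj-irrefl n r)

  robust : Robust (pred (r + r)) graph
  robust S ∣S∣≡k u v u∉S v∉S = subst₂ (Reach graph S) (fromℕ<-toℕ u _) (fromℕ<-toℕ v _)
    (connected few (toℕ u) (toℕ v) (toℕ<n u) (toℕ<n v) (∉⇒χ≡0 S u u∉S) (∉⇒χ≡0 S v v∉S))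
    where
    open CirculantBlock graph S (circulantAdj n r) (λ _ _ e → e) 0 n r r<n ≤-refl (λ _ _ _ _ e → e)
    few : sumRange (χ S) 0 n < r + r
    few = subst (_< r + r) (trans (sym ∣S∣≡k) (∣S∣≡sumRange-χ S))
            (≤-reflexive (suc-pred (r + r) {{>-nonZero (≤-trans 1≤r (m≤m+n r r))}}))

  links≤ : links graph * 2 ≤ n * (r + r)
  links≤ = links-graphOn≤ n (circulantAdj n r) (circulantAdj-sym n r) (circulantAdj-irrefl n r) (r + r) (λ a a<n → circulantAdj-degree n r a r<n a<n)

even-or-odd : ∀ k → Σ ℕ λ r → k ≡ r + r ⊎ k ≡ suc (r + r)
even-or-odd zero    = 0 , inj₁ refl
even-or-odd (suc k) with even-or-odd k
... | r , inj₁ k≡2r   = r , inj₂ (cong suc k≡2r)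
... | r , inj₂ k≡2r+1 = suc r , inj₁ (trans (cong suc k≡2r+1) (cong suc (sym (+-suc r r))))

1≤r+r⇒1≤r : ∀ {r} → 1 ≤ r + r → 1 ≤ r
1≤r+r⇒1≤r {suc r} _ = s≤s z≤n

SparseRobust : ℕ → ℕ → Set
SparseRobust n k = Σ (Graph n) λ G → Robust k G × links G * 2 ≤ n * suc k

sparse-robust-odd : ∀ h r → 3 ≤ h → suc (r + r) ≤ h → SparseRobust (h + h) (suc (r + r))
sparse-robust-odd h r 3≤h k≤h = graph , subst (λ z → Robust z graph) (+-suc r r) robust ,
  subst (λ z → links graph * 2 ≤ (h + h) * z) (cong suc (+-suc r r)) links≤
  where
  instance
    nonZero-2h : NonZero (h + h)
    nonZero-2h = >-nonZero (≤-trans (s≤s z≤n) (≤-trans 3≤h (m≤m+n h h)))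
  r+1<2h : suc r < h + h
  r+1<2h = ≤-<-trans (≤-trans (s≤s (m≤m+n r r)) k≤h) (m<m+n h (≤-trans (s≤s z≤n) 3≤h))
  open Circulant (h + h) (suc r) (s≤s z≤n) r+1<2h

sparse-robust-even : ∀ h r → 1 ≤ r → r + r < h → SparseRobust (h + h) (r + r)
sparse-robust-even h r 1≤r 2r<h = graph , robust 1≤r (rung-cross 2r<h) ,
  subst (λ z → links graph * 2 ≤ (h + h) * z) 2r+1 (links≤ (r + r) (λ X X<h → circulantAdj-degree h r X r<h X<h))
  where
  instance
    nonZero-h : NonZero h
    nonZero-h = >-nonZero (≤-<-trans z≤n 2r<h)
  r<h : r < h
  r<h = ≤-<-trans (m≤m+n r r) 2r<h
  open Prism h r r<h false
  2r+1 : r + r + 1 + 0 ≡ suc (r + r)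
  2r+1 = trans (+-identityʳ _) (+-comm (r + r) 1)

-- With k = h the rungs alone can be cut by taking one end of each, which the twist matching prevents.
sparse-robust-half : ∀ r → 1 ≤ r → SparseRobust ((r + r) + (r + r)) (r + r)
sparse-robust-half r 1≤r = graph , robust 1≤r (twisted-cross refl refl) ,
  subst (λ z → links graph * 2 ≤ (r + r + (r + r)) * z) (pred+1+1 (r + r) (≤-trans 1≤r (m≤m+n r r)))
    (links≤ (r + r ∸ 1) (λ X X<h → circulantAdj-degree≤pred (r + r) r X X<h))
  where
  instance
    nonZero-2r : NonZero (r + r)
    nonZero-2r = >-nonZero (≤-trans 1≤r (m≤m+n r r))
  open Prism (r + r) r (m<m+n r 1≤r) true
  pred+1+1 : ∀ x → 1 ≤ x → x ∸ 1 + 1 + 1 ≡ suc x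
  pred+1+1 (suc x) _ = trans (+-assoc x 1 1) (+-comm x 2)

sparse-robust : ∀ h k → 3 ≤ h → 1 ≤ k → k ≤ h → SparseRobust (h + h) k
sparse-robust h k 3≤h 1≤k k≤h with even-or-odd k
... | r , inj₂ refl = sparse-robust-odd h r 3≤h k≤h
... | r , inj₁ refl with m≤n⇒m<n∨m≡n k≤h
...   | inj₁ 2r<h = sparse-robust-even h r (1≤r+r⇒1≤r 1≤k) 2r<h
...   | inj₂ refl = sparse-robust-half r (1≤r+r⇒1≤r 1≤k)

[h+h]/2≡h : ∀ h → (h + h) / 2 ≡ h
[h+h]/2≡h h = trans (cong (_/ 2) (trans (cong (h +_) (sym (+-identityʳ h))) (*-comm 2 h))) (m*n/n≡m h 2)

module LinkCount (h k : ℕ) (k≤h : k ≤ h) where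

  scaled : ℕ → ℕ
  scaled L = L * 4 + (h + h) * (((h + h) / 2) ∸ k) * 2

  scaled≡ : ∀ L → scaled L ≡ L * 2 * 2 + (h + h) * (h ∸ k) * 2
  scaled≡ L = cong₂ _+_ (sym (*-assoc L 2 2)) (cong (λ z → (h + h) * (z ∸ k) * 2) ([h+h]/2≡h h))

  optimum : (h + h) * suc k * 2 + (h + h) * (h ∸ k) * 2 ≡ (h + h) * (h + h) + (h + h) * 2
  optimum = subst (λ z → (z + z) * suc k * 2 + (z + z) * (h ∸ k) * 2 ≡ (z + z) * (z + z) + (z + z) * 2)
                  (m+[n∸m]≡n k≤h) (identity k (h ∸ k))
    where
    identity : ∀ k d → ((k + d) + (k + d)) * suc k * 2 + ((k + d) + (k + d)) * d * 2
                     ≡ ((k + d) + (k + d)) * ((k + d) + (k + d)) + ((k + d) + (k + d)) * 2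
    identity = solve-∀

  scaled-lower : ∀ L → (h + h) * suc k ≤ L * 2 → (h + h) * (h + h) + (h + h) * 2 ≤ scaled L
  scaled-lower L lower = begin
    (h + h) * (h + h) + (h + h) * 2                  ≡⟨ sym optimum ⟩
    (h + h) * suc k * 2 + (h + h) * (h ∸ k) * 2      ≤⟨ +-monoˡ-≤ _ (*-monoˡ-≤ 2 lower) ⟩
    L * 2 * 2 + (h + h) * (h ∸ k) * 2                ≡⟨ sym (scaled≡ L) ⟩
    scaled L ∎
    where open ≤-Reasoning

  scaled-exact : ∀ L → L * 2 ≡ (h + h) * suc k → scaled L ≡ (h + h) * (h + h) + (h + h) * 2
  scaled-exact L exact = begin
    scaled L                                         ≡⟨ scaled≡ L ⟩
    L * 2 * 2 + (h + h) * (h ∸ k) * 2                ≡⟨ cong (λ z → z * 2 + (h + h) * (h ∸ k) * 2) exact ⟩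
    (h + h) * suc k * 2 + (h + h) * (h ∸ k) * 2      ≡⟨ optimum ⟩
    (h + h) * (h + h) + (h + h) * 2 ∎
    where open ≡-Reasoning

MinimumLinks : ℕ → ℕ → Set
MinimumLinks N k =
  (Σ (Graph N) λ G → Robust k G × links G * 4 + N * ((N / 2) ∸ k) * 2 ≡ N * N + N * 2)
  × ((G : Graph N) → Robust k G → N * N + N * 2 ≤ links G * 4 + N * ((N / 2) ∸ k) * 2)

minimum-links : ∀ h k → 3 ≤ h → 1 ≤ k → k ≤ h → MinimumLinks (h + h) k
minimum-links h k 3≤h 1≤k k≤h with sparse-robust h k 3≤h 1≤k k≤h
... | G , robust , upper = (G , robust , scaled-exact (links G) (≤-antisym upper (lower-bound G robust))) ,
                           (λ G robust → scaled-lower (links G) (lower-bound G robust))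
  where
  open LinkCount h k k≤h
  k+2≤2h : k + 2 ≤ h + h
  k+2≤2h = +-mono-≤ k≤h (≤-trans (s≤s (s≤s z≤n)) 3≤h)
  lower-bound : ∀ G → Robust k G → (h + h) * suc k ≤ links G * 2
  lower-bound G robust = robust⇒links≥ G k robust k+2≤2h

corollary1 : (N Nf : ℕ) → 2 ∣ N → 6 ≤ N → 1 ≤ Nf → 2 * Nf ≤ N →
    (Σ (Graph N) λ G → Robust Nf G ×
        links G * 4 + N * ((N / 2) ∸ Nf) * 2 ≡ N * N + N * 2)
    × ((G : Graph N) → Robust Nf G →
        N * N + N * 2 ≤ links G * 4 + N * ((N / 2) ∸ Nf) * 2)
corollary1 N Nf (divides h N≡h*2) 6≤N 1≤Nf 2Nf≤N =
  subst (λ M → MinimumLinks M Nf) (sym N≡2h) (minimum-links h Nf 3≤h 1≤Nf Nf≤h)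
  where
  N≡2h : N ≡ h + h
  N≡2h = trans N≡h*2 (trans (*-comm h 2) (cong (h +_) (+-identityʳ h)))
  3≤h : 3 ≤ h
  3≤h = *-cancelˡ-≤ 2 (subst (6 ≤_) (trans N≡h*2 (*-comm h 2)) 6≤N)
  Nf≤h : Nf ≤ h
  Nf≤h = *-cancelˡ-≤ 2 (subst (2 * Nf ≤_) (trans N≡h*2 (*-comm h 2)) 2Nf≤N)
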